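{- Let $G$ be a diameter-2-critical graph with $n$ vertices and $m$ edges, with critical paths fixed as described in the context, and let $c>0$. If either $|\mathcal{T}_2|\ge \frac{5c}{2}\,nm$ or $|\mathcal{T}_3^*|\ge \frac{5c}{6}\,nm$, then \[\sum_{v\in V(G)} d_v^2 \le \left(\tfrac65 - c\right) nm.\]
   Context: All graphs are finite and simple; $d_v$ is the degree of $v$ and $d_G(x,y)$ the shortest-path distance. $G$ is diameter-2-critical if its diameter is 2 and for every edge $e$, $G-e$ has diameter greater than 2. For $0\le i\le 3$, $\mathcal{T}_i$ is the set of unordered vertex triples $\{x,y,z\}$ whose induced subgraph has exactly $i$ edges. A vertex pair $\{x,y\}$ and edge $e$ are associated if $d_G(x,y)\le 2$ but $d_{G-e}(x,y)>2$; $\{x,y\}$ is critical if some edge is associated with it. For each critical pair one shortest $(x,y)$-path $P_{xy}$ is arbitrarily selected; for an edge $e$, $\mathcal{P}(e)$ is the set of these selected paths $P_{xy}$ with $\{x,y\}$ associated with $e$. For a triangle $T\in\mathcal{T}_3$, a vertex $v\notin T$ is a foot of $T$ if there are $x,y\in T$ with the path $vxy\in\mathcal{P}(xy)$. $\mathcal{T}_3^*$ is the set of triangles having at least three feet.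
   Formalization: The constant c ranges over the positive rationals. -}

module Defs where

open import Data.Nat using (ℕ; zero; suc; _+_; _*_; _<ᵇ_; _≤ᵇ_; _≡ᵇ_)
open import Data.Bool using (Bool; true; false; _∧_; _∨_; not; if_then_else_; T)
open import Data.Fin using (Fin; toℕ)
open import Data.List using (List; map; allFin)
open import Data.Nat.ListAction using (sum)
open import Data.Bool.ListAction using (any)
open import Data.Product using (Σ; _×_; ∃; ∃-syntax)
open import Relation.Nullary using (¬_)
open import Relation.Binary.PropositionalEquality using (_≡_)
open import Data.Integer using (+_)
open import Data.Rational using (ℚ; _/_)

_=ᶠ_ : ∀ {n} → Fin n → Fin n → Bool
i =ᶠ j = toℕ i ≡ᵇ toℕ j

_<ᶠ_ : ∀ {n} → Fin n → Fin n → Bool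
i <ᶠ j = toℕ i <ᵇ toℕ j

record Graph (n : ℕ) : Set where
  field
    adj   : Fin n → Fin n → Bool
    sym   : ∀ x y → adj x y ≡ adj y x
    irrefl : ∀ x → adj x x ≡ false
open Graph public

ΣV : ∀ {n} → (Fin n → ℕ) → ℕ
ΣV {n} f = sum (map f (allFin n))

anyV : ∀ {n} → (Fin n → Bool) → Bool
anyV {n} p = any p (allFin n)

[_] : Bool → ℕ
[ b ] = if b then 1 else 0

delEdge : ∀ {n} → (Fin n → Fin n → Bool) → Fin n → Fin n → (Fin n → Fin n → Bool)
delEdge A a b u v = A u v ∧ not ((u =ᶠ a ∧ v =ᶠ b) ∨ (u =ᶠ b ∧ v =ᶠ a))

dist≤2 : ∀ {n} → (Fin n → Fin n → Bool) → Fin n → Fin n → Bool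
dist≤2 A x y = (x =ᶠ y) ∨ A x y ∨ anyV (λ w → A x w ∧ A w y)

degree : ∀ {n} → Graph n → Fin n → ℕ
degree G v = ΣV (λ u → [ adj G v u ])

edgeCount : ∀ {n} → Graph n → ℕ
edgeCount G = ΣV (λ i → ΣV (λ j → [ (i <ᶠ j) ∧ adj G i j ]))

sumDegSq : ∀ {n} → Graph n → ℕ
sumDegSq G = ΣV (λ v → degree G v * degree G v)

Diameter2 : ∀ {n} → Graph n → Set
Diameter2 G = (∀ x y → T (dist≤2 (adj G) x y))
            × (∃[ x ] ∃[ y ] ¬ (x ≡ y) × T (not (adj G x y)))

Diameter2Critical : ∀ {n} → Graph n → Set
Diameter2Critical G = Diameter2 G
  × (∀ a b → T (adj G a b) → ∃[ x ] ∃[ y ] T (not (dist≤2 (delEdge (adj G) a b) x y)))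

assoc : ∀ {n} → Graph n → Fin n → Fin n → Fin n → Fin n → Bool
assoc G x y a b = adj G a b ∧ dist≤2 (adj G) x y ∧ not (dist≤2 (delEdge (adj G) a b) x y)

critical : ∀ {n} → Graph n → Fin n → Fin n → Bool
critical G x y = not (x =ᶠ y) ∧ anyV (λ a → anyV (λ b → assoc G x y a b))

-- For an adjacent critical pair the unique
-- shortest path is the edge itself; for a non-adjacent critical pair {x,y}
-- the selected shortest path is x (mid x y) y.  Unordered pairs: mid symmetric.
record PathSelection {n : ℕ} (G : Graph n) : Set where
  field
    mid     : Fin n → Fin n → Fin n
    mid-sym : ∀ x y → T (critical G x y) → T (not (adj G x y)) → mid x y ≡ mid y x
    mid-adj : ∀ x y → T (critical G x y) → T (not (adj G x y)) →
              T (adj G x (mid x y)) × T (adj G (mid x y) y)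
open PathSelection public

-- the path v x y is the selected path P_{vy} and belongs to P(xy)
pathInP : ∀ {n} {G : Graph n} → PathSelection G → Fin n → Fin n → Fin n → Bool
pathInP {G = G} S v x y =
  not (v =ᶠ y) ∧ not (adj G v y) ∧ critical G v y ∧ (mid S v y =ᶠ x) ∧ assoc G v y x y

isFoot : ∀ {n} {G : Graph n} → PathSelection G → Fin n → Fin n → Fin n → Fin n → Bool
isFoot S a b c v =
  not ((v =ᶠ a) ∨ (v =ᶠ b) ∨ (v =ᶠ c)) ∧
  (pathInP S v a b ∨ pathInP S v b a ∨ pathInP S v a c ∨
   pathInP S v c a ∨ pathInP S v b c ∨ pathInP S v c b)

feetCount : ∀ {n} {G : Graph n} → PathSelection G → Fin n → Fin n → Fin n → ℕ
feetCount S a b c = ΣV (λ v → [ isFoot S a b c v ])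

triEdges : ∀ {n} → Graph n → Fin n → Fin n → Fin n → ℕ
triEdges G i j k = [ adj G i j ] + [ adj G i k ] + [ adj G j k ]

ΣTriples : ∀ {n} → (Fin n → Fin n → Fin n → Bool) → ℕ
ΣTriples p = ΣV (λ i → ΣV (λ j → ΣV (λ k → [ (i <ᶠ j) ∧ (j <ᶠ k) ∧ p i j k ])))

countT2 : ∀ {n} → Graph n → ℕ
countT2 G = ΣTriples (λ i j k → triEdges G i j k ≡ᵇ 2)

countT3* : ∀ {n} {G : Graph n} → PathSelection G → ℕ
countT3* {G = G} S = ΣTriples (λ i j k → (triEdges G i j k ≡ᵇ 3) ∧ (3 ≤ᵇ feetCount S i j k))

ℕ→ℚ : ℕ → ℚ
ℕ→ℚ k = + k / 1

-- Count ordered triples of distinct vertices by the number k of edges they span (6|T_k| of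
-- them).  Expanding d_v² and n·2m over ordered pairs and triples gives
--   Σ d_v² = 2m + 2|T₂| + 6|T₃|   and   (n − 2) m = |T₁| + 2|T₂| + 3|T₃|.
-- The graph theory enters through the feet of triangles.  The three edges of a triangle are
-- critical, and a pair at distance > 2 in G − e produces a foot next to one end of e and missing the
-- opposite vertex, so every triangle has at least two feet.  A foot w of xyz with selected path
-- w x y is adjacent to x alone, and x is the only common neighbour of w and y; hence
-- (triangle, foot) ↦ {w} ∪ (triangle − x), a triple with exactly one edge, is injective, and
-- 2|T₃| + |T₃*| ≤ |T₁|.  Altogether 5 Σ d_v² + 2|T₂| + 6|T₃*| ≤ 6nm − 2m, and either hypothesis
-- on c turns this into the bound.

module Submission where

open import Defs hiding (sym)
open import Data.Bool using (Bool; true; false; _∧_; _∨_; not; T)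
open import Data.Bool.Properties using (T-∧; T-∨; ∧-comm; ∧-assoc; ∨-comm; ∧-zeroʳ; ∧-identityʳ)
open import Data.Nat using (ℕ; zero; suc; _+_; _*_; _≡ᵇ_; _<ᵇ_; _≤ᵇ_)
open import Data.Nat.Properties using (+-identityʳ; *-zeroʳ; *-comm; *-distribʳ-+; ≡ᵇ⇒≡; ≡⇒≡ᵇ)
open import Data.Nat.Tactic.RingSolver using (solve-∀)
open import Data.Fin using (Fin; zero; suc; toℕ)
open import Data.Fin.Properties using (toℕ-injective; suc-injective; _≟_)
open import Data.Product using (_×_; _,_; proj₁; proj₂; ∃-syntax)
open import Data.Sum using (_⊎_; inj₁; inj₂; map₂; [_,_]′)
open import Data.Empty using (⊥-elim)
open import Function.Bundles using (Equivalence)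
open import Relation.Nullary using (¬_; yes; no)
open import Relation.Nullary.Decidable using (T?)
open import Relation.Binary.PropositionalEquality hiding ([_])
open import Data.List using (allFin)
open import Data.List.Membership.Propositional using (lose)
open import Data.List.Membership.Propositional.Properties using (∈-allFin)
open import Data.List.Relation.Unary.Any using (satisfied)
open import Data.List.Relation.Unary.Any.Properties using (any⁺; any⁻)

private
  T-∧⁻ : ∀ {a b} → T (a ∧ b) → T a × T b
  T-∧⁻ {a} {b} = Equivalence.to (T-∧ {a} {b})

  T-∧⁺ : ∀ {a b} → T a → T b → T (a ∧ b)
  T-∧⁺ {a} {b} ta tb = Equivalence.from (T-∧ {a} {b}) (ta , tb)

  T-∨⁻ : ∀ {a b} → T (a ∨ b) → T a ⊎ T b
  T-∨⁻ {a} {b} = Equivalence.to (T-∨ {a} {b})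

  T-∨⁺ : ∀ {a b} → T a ⊎ T b → T (a ∨ b)
  T-∨⁺ {a} {b} = Equivalence.from (T-∨ {a} {b})

  T-not⁺ : ∀ {a} → ¬ T a → T (not a)
  T-not⁺ {false} _  = _
  T-not⁺ {true}  ¬t = ¬t _

  T-not⁻ : ∀ {a} → T (not a) → ¬ T a
  T-not⁻ {false} _ ()

T⇒≡true : ∀ {b} → T b → b ≡ true
T⇒≡true {true} _ = refl

[T]≡1 : ∀ {b} → T b → [ b ] ≡ 1
[T]≡1 {true} _ = refl

[∧]≡[]*[] : ∀ a b → [ a ∧ b ] ≡ [ a ] * [ b ]
[∧]≡[]*[] true  b = sym (+-identityʳ [ b ])
[∧]≡[]*[] false b = refl

[]≡Σ[∧] : ∀ x p q r → (T x → [ p ] + [ q ] + [ r ] ≡ 1) → [ x ] ≡ [ x ∧ p ] + [ x ∧ q ] + [ x ∧ r ]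
[]≡Σ[∧] false p q r _   = refl
[]≡Σ[∧] true  p q r one = sym (one _)

only-first : ∀ {p q r} → [ p ] + [ q ] + [ r ] ≡ 1 → T p → T (not q) × T (not r)
only-first {true} {false} {false} _  _ = _ , _
only-first {true} {true}          () _
only-first {true} {false} {true}  () _

[]*[]≡diagonal+distinct : ∀ p q e x y → (T e → p ≡ q) → (T p → x ≡ false) → (T q → y ≡ false) →
  [ p ] * [ q ] ≡ [ e ] * [ q ] + [ p ] * [ q ] * [ not x ∧ not y ∧ not e ]
[]*[]≡diagonal+distinct false q     false x y _   _  _  = refl
[]*[]≡diagonal+distinct true  false false x y _   _  _  = refl
[]*[]≡diagonal+distinct true  true  false x y _   ¬x ¬y rewrite ¬x _ | ¬y _ = refl
[]*[]≡diagonal+distinct p     q     true  x y p≡q ¬x ¬y rewrite p≡q _ with q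
... | false = refl
... | true  rewrite ¬x _ | ¬y _ = refl

[]≡ends+distinct : ∀ x e ex ey → (T x → e ≡ false) → (T x → T ex → ey ≡ false) →
  [ x ] ≡ [ ex ] * [ x ] + [ ey ] * [ x ] + [ x ] * [ not ex ∧ not ey ∧ not e ]
[]≡ends+distinct false e ex    ey    _  _   rewrite *-zeroʳ [ ex ] | *-zeroʳ [ ey ] = refl
[]≡ends+distinct true  e true  ey    _  ¬ey rewrite ¬ey _ _ = refl
[]≡ends+distinct true  e false true  _  _   = refl
[]≡ends+distinct true  e false false ¬e _   rewrite ¬e _ = refl

edges-by-class : ∀ p q r → let e = [ p ] + [ q ] + [ r ] in
  e ≡ [ e ≡ᵇ 1 ] + 2 * [ e ≡ᵇ 2 ] + 3 * [ e ≡ᵇ 3 ]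
edges-by-class true  true  true  = refl
edges-by-class true  true  false = refl
edges-by-class true  false true  = refl
edges-by-class true  false false = refl
edges-by-class false true  true  = refl
edges-by-class false true  false = refl
edges-by-class false false true  = refl
edges-by-class false false false = refl

pairs-by-class : ∀ p q r → let e = [ p ] + [ q ] + [ r ] in
  [ p ] * [ q ] + [ p ] * [ r ] + [ q ] * [ r ] ≡ [ e ≡ᵇ 2 ] + 3 * [ e ≡ᵇ 3 ]
pairs-by-class true  true  true  = refl
pairs-by-class true  true  false = refl
pairs-by-class true  false true  = refl
pairs-by-class true  false false = refl
pairs-by-class false true  true  = refl
pairs-by-class false true  false = refl
pairs-by-class false false true  = refl
pairs-by-class false false false = refl

lone-by-position : ∀ p q r d → [ [ p ] + [ q ] + [ r ] ≡ᵇ 1 ] * [ d ] ≡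
  [ d ∧ r ∧ not p ∧ not q ] + [ d ∧ q ∧ not p ∧ not r ] + [ d ∧ p ∧ not q ∧ not r ]
lone-by-position p     q     r     false = *-zeroʳ [ [ p ] + [ q ] + [ r ] ≡ᵇ 1 ]
lone-by-position true  true  true  true  = refl
lone-by-position true  true  false true  = refl
lone-by-position true  false true  true  = refl
lone-by-position true  false false true  = refl
lone-by-position false true  true  true  = refl
lone-by-position false true  false true  = refl
lone-by-position false false true  true  = refl
lone-by-position false false false true  = refl

≡ᵇ-sym : ∀ x y → (x ≡ᵇ y) ≡ (y ≡ᵇ x)
≡ᵇ-sym zero    zero    = refl
≡ᵇ-sym zero    (suc y) = refl
≡ᵇ-sym (suc x) zero    = refl
≡ᵇ-sym (suc x) (suc y) = ≡ᵇ-sym x y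

[≢ᵇ]≡[<ᵇ]+[>ᵇ] : ∀ x y → [ not (x ≡ᵇ y) ] ≡ [ x <ᵇ y ] + [ y <ᵇ x ]
[≢ᵇ]≡[<ᵇ]+[>ᵇ] zero    zero    = refl
[≢ᵇ]≡[<ᵇ]+[>ᵇ] zero    (suc y) = refl
[≢ᵇ]≡[<ᵇ]+[>ᵇ] (suc x) zero    = refl
[≢ᵇ]≡[<ᵇ]+[>ᵇ] (suc x) (suc y) = [≢ᵇ]≡[<ᵇ]+[>ᵇ] x y

sortedᵇ : ℕ → ℕ → ℕ → Bool
sortedᵇ x y z = (x <ᵇ y) ∧ (y <ᵇ z)

-- Shifting all three numbers by one changes neither side, so only the cases with a zero remain.
[distinctᵇ]≡Σsorted : ∀ x y z →
  [ not (x ≡ᵇ y) ∧ not (x ≡ᵇ z) ∧ not (y ≡ᵇ z) ] ≡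
  [ sortedᵇ x y z ] + [ sortedᵇ x z y ] + [ sortedᵇ y x z ] +
  [ sortedᵇ y z x ] + [ sortedᵇ z x y ] + [ sortedᵇ z y x ]
[distinctᵇ]≡Σsorted zero    zero    zero    = refl
[distinctᵇ]≡Σsorted zero    zero    (suc z) = refl
[distinctᵇ]≡Σsorted zero    (suc y) zero    = refl
[distinctᵇ]≡Σsorted (suc x) zero    zero    = refl
[distinctᵇ]≡Σsorted zero    (suc y) (suc z)
  rewrite ∧-zeroʳ (y <ᵇ z) | ∧-zeroʳ (z <ᵇ y) =
  trans ([≢ᵇ]≡[<ᵇ]+[>ᵇ] y z) (pad [ y <ᵇ z ] [ z <ᵇ y ])
  where
    pad : ∀ a b → a + b ≡ a + b + 0 + 0 + 0 + 0
    pad = solve-∀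
[distinctᵇ]≡Σsorted (suc x) zero    (suc z)
  rewrite ∧-zeroʳ (x <ᵇ z) | ∧-zeroʳ (z <ᵇ x) | ∧-identityʳ (not (x ≡ᵇ z)) =
  trans ([≢ᵇ]≡[<ᵇ]+[>ᵇ] x z) (pad [ x <ᵇ z ] [ z <ᵇ x ])
  where
    pad : ∀ a b → a + b ≡ 0 + 0 + a + b + 0 + 0
    pad = solve-∀
[distinctᵇ]≡Σsorted (suc x) (suc y) zero
  rewrite ∧-zeroʳ (x <ᵇ y) | ∧-zeroʳ (y <ᵇ x) | ∧-identityʳ (not (x ≡ᵇ y)) =
  trans ([≢ᵇ]≡[<ᵇ]+[>ᵇ] x y) (pad [ x <ᵇ y ] [ y <ᵇ x ])
  where
    pad : ∀ a b → a + b ≡ 0 + 0 + 0 + 0 + a + b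
    pad = solve-∀
[distinctᵇ]≡Σsorted (suc x) (suc y) (suc z) = [distinctᵇ]≡Σsorted x y z

module _ {n : ℕ} where

  T-=ᶠ-refl : (i : Fin n) → T (i =ᶠ i)
  T-=ᶠ-refl i = ≡⇒≡ᵇ (toℕ i) (toℕ i) refl

  T-=ᶠ⇒≡ : {i j : Fin n} → T (i =ᶠ j) → i ≡ j
  T-=ᶠ⇒≡ {i} {j} t = toℕ-injective (≡ᵇ⇒≡ (toℕ i) (toℕ j) t)

  =ᶠ-sym : (i j : Fin n) → (i =ᶠ j) ≡ (j =ᶠ i)
  =ᶠ-sym i j = ≡ᵇ-sym (toℕ i) (toℕ j)

  ≢⇒=ᶠ-false : {i j : Fin n} → ¬ i ≡ j → (i =ᶠ j) ≡ false
  ≢⇒=ᶠ-false {i} {j} i≢j with i =ᶠ j in eq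
  ... | false = refl
  ... | true  = ⊥-elim (i≢j (T-=ᶠ⇒≡ (subst T (sym eq) _)))

module Sums where

  open import Data.Nat using (_≤_; z≤n)
  open import Data.Nat.Properties using (+-*-semiring; +-mono-≤; +-monoʳ-≤; m≤m+n; m≤n+m; ≤-trans; ≤-reflexive; +-comm)
  open import Data.List using (tabulate)
  open import Data.List.Properties using (map-cong; map-tabulate)
  import Data.Nat.ListAction as List
  open import Algebra.Properties.Semiring.Sum +-*-semiring
    using (sum; ∑-distrib-+; ∑-comm; *-distribˡ-sum; sum-replicate-zero)

  ΣV≡sum : ∀ {n} (f : Fin n → ℕ) → ΣV f ≡ sum f
  ΣV≡sum f = trans (cong List.sum (map-tabulate (λ i → i) f)) (sum-tabulate f)
    where
      sum-tabulate : ∀ {n} (f : Fin n → ℕ) → List.sum (tabulate f) ≡ sum f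
      sum-tabulate {zero}  f = refl
      sum-tabulate {suc n} f = cong (f zero +_) (sum-tabulate (λ i → f (suc i)))

  ΣV-suc : ∀ {n} (f : Fin (suc n) → ℕ) → ΣV f ≡ f zero + ΣV (λ i → f (suc i))
  ΣV-suc f = trans (ΣV≡sum f) (cong (f zero +_) (sym (ΣV≡sum (λ i → f (suc i)))))

  module _ {n : ℕ} where

    ΣV-cong : {f g : Fin n → ℕ} → (∀ i → f i ≡ g i) → ΣV f ≡ ΣV g
    ΣV-cong f≗g = cong List.sum (map-cong f≗g (allFin n))

    ΣV-distrib-+ : (f g : Fin n → ℕ) → ΣV (λ i → f i + g i) ≡ ΣV f + ΣV g
    ΣV-distrib-+ f g = begin
      ΣV (λ i → f i + g i)  ≡⟨ ΣV≡sum (λ i → f i + g i) ⟩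
      sum (λ i → f i + g i) ≡⟨ ∑-distrib-+ f g ⟩
      sum f + sum g         ≡⟨ sym (cong₂ _+_ (ΣV≡sum f) (ΣV≡sum g)) ⟩
      ΣV f + ΣV g           ∎
      where open ≡-Reasoning

    ΣV-*ˡ : (k : ℕ) (f : Fin n → ℕ) → ΣV (λ i → k * f i) ≡ k * ΣV f
    ΣV-*ˡ k f = trans (ΣV≡sum (λ i → k * f i)) (sym (trans (cong (k *_) (ΣV≡sum f)) (*-distribˡ-sum k f)))

    ΣV-*ʳ : (k : ℕ) (f : Fin n → ℕ) → ΣV (λ i → f i * k) ≡ ΣV f * k
    ΣV-*ʳ k f = trans (ΣV-cong (λ i → *-comm (f i) k)) (trans (ΣV-*ˡ k f) (*-comm k (ΣV f)))

    ΣV-comm : (f : Fin n → Fin n → ℕ) → ΣV (λ i → ΣV (λ j → f i j)) ≡ ΣV (λ j → ΣV (λ i → f i j))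
    ΣV-comm f = begin
      ΣV (λ i → ΣV (λ j → f i j))   ≡⟨ trans (ΣV-cong (λ i → ΣV≡sum (f i))) (ΣV≡sum (λ i → sum (f i))) ⟩
      sum (λ i → sum (λ j → f i j)) ≡⟨ ∑-comm f ⟩
      sum (λ j → sum (λ i → f i j)) ≡⟨ sym (trans (ΣV-cong (λ j → ΣV≡sum (λ i → f i j)))
                                                  (ΣV≡sum (λ j → sum (λ i → f i j)))) ⟩
      ΣV (λ j → ΣV (λ i → f i j))   ∎
      where open ≡-Reasoning

    ΣV-const : (k : ℕ) → ΣV {n} (λ _ → k) ≡ n * k
    ΣV-const k = trans (ΣV≡sum {n} (λ _ → k)) (sum-const n)
      where
        sum-const : ∀ m → sum {m} (λ _ → k) ≡ m * k
        sum-const zero    = refl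
        sum-const (suc m) = cong (k +_) (sum-const m)

  ΣV-mono-≤ : ∀ {n} {f g : Fin n → ℕ} → (∀ i → f i ≤ g i) → ΣV f ≤ ΣV g
  ΣV-mono-≤ {zero}          _   = z≤n
  ΣV-mono-≤ {suc n} {f} {g} f≤g =
    subst₂ _≤_ (sym (ΣV-suc f)) (sym (ΣV-suc g)) (+-mono-≤ (f≤g zero) (ΣV-mono-≤ (λ i → f≤g (suc i))))

  ΣV-[=ᶠ]* : ∀ {n} (i : Fin n) (f : Fin n → ℕ) → ΣV (λ j → [ i =ᶠ j ] * f j) ≡ f i
  ΣV-[=ᶠ]* i f = trans (ΣV≡sum (λ j → [ i =ᶠ j ] * f j)) (sum-delta i f)
    where
      sum-delta : ∀ {n} (i : Fin n) (f : Fin n → ℕ) → sum (λ j → [ i =ᶠ j ] * f j) ≡ f i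
      sum-delta {suc n} zero    f =
        trans (cong₂ _+_ (+-identityʳ (f zero)) (sum-replicate-zero n)) (+-identityʳ (f zero))
      sum-delta         (suc i) f = sum-delta i (λ j → f (suc j))

  ΣV-pair-≤ : ∀ {n} (f : Fin n → ℕ) {i j : Fin n} → ¬ i ≡ j → f i + f j ≤ ΣV f
  ΣV-pair-≤ f {i} {j} i≢j = subst (f i + f j ≤_) (sym (ΣV≡sum f)) (sum-pair f i j i≢j)
    where
      sum-one : ∀ {n} (f : Fin n → ℕ) i → f i ≤ sum f
      sum-one f zero    = m≤m+n _ _
      sum-one f (suc i) = ≤-trans (sum-one (λ k → f (suc k)) i) (m≤n+m _ _)
      sum-pair : ∀ {n} (f : Fin n → ℕ) i j → ¬ i ≡ j → f i + f j ≤ sum f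
      sum-pair f zero    zero    i≢j = ⊥-elim (i≢j refl)
      sum-pair f zero    (suc j) _   = +-monoʳ-≤ (f zero) (sum-one (λ k → f (suc k)) j)
      sum-pair f (suc i) zero    _   =
        subst (_≤ sum f) (+-comm (f zero) (f (suc i))) (+-monoʳ-≤ (f zero) (sum-one (λ k → f (suc k)) i))
      sum-pair f (suc i) (suc j) i≢j =
        ≤-trans (sum-pair (λ k → f (suc k)) i j (λ i≡j → i≢j (cong suc i≡j))) (m≤n+m _ _)

  ΣV-[]-none : ∀ {n} (p : Fin n → Bool) → (∀ i → ¬ T (p i)) → ΣV (λ i → [ p i ]) ≡ 0
  ΣV-[]-none {n} p ¬p = trans (ΣV-cong [p]≡0) (trans (ΣV-const {n} 0) (*-zeroʳ n))
    where
      [p]≡0 : ∀ i → [ p i ] ≡ 0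
      [p]≡0 i with p i | ¬p i
      ... | false | _  = refl
      ... | true  | ¬t = ⊥-elim (¬t _)

  ΣV-[]-≤1 : ∀ {n} (p : Fin n → Bool) → (∀ i j → T (p i) → T (p j) → i ≡ j) → ΣV (λ i → [ p i ]) ≤ 1
  ΣV-[]-≤1 {zero}  p _    = z≤n
  ΣV-[]-≤1 {suc n} p uniq rewrite ΣV-suc (λ i → [ p i ]) with p zero in p0
  ... | false = ΣV-[]-≤1 (λ i → p (suc i)) (λ i j pi pj → suc-injective (uniq (suc i) (suc j) pi pj))
  ... | true  = ≤-reflexive (cong suc (ΣV-[]-none (λ i → p (suc i)) ¬p))
    where
      ¬p : ∀ i → ¬ T (p (suc i))
      ¬p i t with uniq zero (suc i) (subst T (sym p0) _) t
      ... | ()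

  ΣV-[]-≤ : ∀ {n} (p : Fin n → Bool) (q : Bool) →
    (∀ i j → T (p i) → T (p j) → i ≡ j) → (∀ i → T (p i) → T q) → ΣV (λ i → [ p i ]) ≤ [ q ]
  ΣV-[]-≤ p true  uniq _   = ΣV-[]-≤1 p uniq
  ΣV-[]-≤ p false _    p⇒q = ≤-reflexive (ΣV-[]-none p p⇒q)

open Sums

module Triples {n : ℕ} where

  open import Data.Nat using (_≤_)

  Σ3 : (Fin n → Fin n → Fin n → ℕ) → ℕ
  Σ3 f = ΣV λ i → ΣV λ j → ΣV λ k → f i j k

  Σ3-cong : ∀ {f g} → (∀ i j k → f i j k ≡ g i j k) → Σ3 f ≡ Σ3 g
  Σ3-cong f≗g = ΣV-cong λ i → ΣV-cong λ j → ΣV-cong λ k → f≗g i j k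

  Σ3-mono-≤ : ∀ {f g} → (∀ i j k → f i j k ≤ g i j k) → Σ3 f ≤ Σ3 g
  Σ3-mono-≤ f≤g = ΣV-mono-≤ λ i → ΣV-mono-≤ λ j → ΣV-mono-≤ λ k → f≤g i j k

  Σ3-distrib-+ : ∀ f g → Σ3 (λ i j k → f i j k + g i j k) ≡ Σ3 f + Σ3 g
  Σ3-distrib-+ f g = trans
    (ΣV-cong λ i → trans (ΣV-cong λ j → ΣV-distrib-+ (f i j) (g i j))
                         (ΣV-distrib-+ (λ j → ΣV (f i j)) (λ j → ΣV (g i j))))
    (ΣV-distrib-+ (λ i → ΣV λ j → ΣV (f i j)) (λ i → ΣV λ j → ΣV (g i j)))

  Σ3-*ˡ : ∀ m f → Σ3 (λ i j k → m * f i j k) ≡ m * Σ3 f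
  Σ3-*ˡ m f = trans
    (ΣV-cong λ i → trans (ΣV-cong λ j → ΣV-*ˡ m (f i j)) (ΣV-*ˡ m (λ j → ΣV (f i j))))
    (ΣV-*ˡ m (λ i → ΣV λ j → ΣV (f i j)))

  Σ3-swap₁₂ : ∀ f → Σ3 f ≡ Σ3 (λ i j k → f j i k)
  Σ3-swap₁₂ f = ΣV-comm (λ i j → ΣV (f i j))

  Σ3-swap₂₃ : ∀ f → Σ3 f ≡ Σ3 (λ i j k → f i k j)
  Σ3-swap₂₃ f = ΣV-cong λ i → ΣV-comm (f i)

  Σ3-rotate : ∀ f → Σ3 f ≡ Σ3 (λ i j k → f j k i)
  Σ3-rotate f = trans (Σ3-swap₂₃ f) (Σ3-swap₁₂ (λ i j k → f i k j))

  Σ3-ΣV-comm : (f : Fin n → Fin n → Fin n → Fin n → ℕ) →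
    Σ3 (λ i j k → ΣV (f i j k)) ≡ ΣV (λ l → Σ3 (λ i j k → f i j k l))
  Σ3-ΣV-comm f = trans
    (ΣV-cong λ i → trans (ΣV-cong λ j → ΣV-comm (f i j)) (ΣV-comm (λ j l → ΣV (λ k → f i j k l))))
    (ΣV-comm (λ i l → ΣV λ j → ΣV λ k → f i j k l))

  Σ3-positions : ∀ f → Σ3 (λ i j k → f i j k + f j i k + f k i j) ≡ 3 * Σ3 f
  Σ3-positions f = begin
    Σ3 (λ i j k → f i j k + f j i k + f k i j)
      ≡⟨ Σ3-distrib-+ (λ i j k → f i j k + f j i k) (λ i j k → f k i j) ⟩
    Σ3 (λ i j k → f i j k + f j i k) + Σ3 (λ i j k → f k i j)
      ≡⟨ cong (_+ Σ3 (λ i j k → f k i j)) (Σ3-distrib-+ f (λ i j k → f j i k)) ⟩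
    Σ3 f + Σ3 (λ i j k → f j i k) + Σ3 (λ i j k → f k i j)
      ≡⟨ sym (cong₂ (λ x y → Σ3 f + x + y) (Σ3-swap₁₂ f) (sym (Σ3-rotate (λ i j k → f k i j)))) ⟩
    Σ3 f + Σ3 f + Σ3 f
      ≡⟨ thrice (Σ3 f) ⟩
    3 * Σ3 f ∎
    where
      open ≡-Reasoning
      thrice : ∀ x → x + x + x ≡ 3 * x
      thrice = solve-∀

  symmetrize : (Fin n → Fin n → Fin n → ℕ) → Fin n → Fin n → Fin n → ℕ
  symmetrize h i j k = (h i j k + h i k j) + (h j i k + h j k i) + (h k i j + h k j i)

  Σ3-symmetrize : ∀ h → Σ3 (symmetrize h) ≡ 6 * Σ3 h
  Σ3-symmetrize h = begin
    Σ3 (symmetrize h)              ≡⟨ Σ3-positions (λ i j k → h i j k + h i k j) ⟩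
    3 * Σ3 (λ i j k → h i j k + h i k j) ≡⟨ cong (3 *_) (Σ3-distrib-+ h (λ i j k → h i k j)) ⟩
    3 * (Σ3 h + Σ3 (λ i j k → h i k j)) ≡⟨ cong (λ x → 3 * (Σ3 h + x)) (sym (Σ3-swap₂₃ h)) ⟩
    3 * (Σ3 h + Σ3 h)              ≡⟨ sixfold (Σ3 h) ⟩
    6 * Σ3 h                       ∎
    where
      open ≡-Reasoning
      sixfold : ∀ x → 3 * (x + x) ≡ 6 * x
      sixfold = solve-∀

  distinct : Fin n → Fin n → Fin n → Bool
  distinct i j k = not (i =ᶠ j) ∧ not (i =ᶠ k) ∧ not (j =ᶠ k)

  distinct⁺ : ∀ {i j k} → ¬ i ≡ j → ¬ i ≡ k → ¬ j ≡ k → T (distinct i j k)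
  distinct⁺ i≢j i≢k j≢k rewrite ≢⇒=ᶠ-false i≢j | ≢⇒=ᶠ-false i≢k | ≢⇒=ᶠ-false j≢k = _

  distinct-swap₁₂ : ∀ i j k → distinct j i k ≡ distinct i j k
  distinct-swap₁₂ i j k rewrite =ᶠ-sym j i = cong (not (i =ᶠ j) ∧_) (∧-comm (not (j =ᶠ k)) (not (i =ᶠ k)))

  distinct-swap₂₃ : ∀ i j k → distinct i k j ≡ distinct i j k
  distinct-swap₂₃ i j k rewrite =ᶠ-sym k j = begin
    a ∧ b ∧ c   ≡⟨ sym (∧-assoc a b c) ⟩
    (a ∧ b) ∧ c ≡⟨ cong (_∧ c) (∧-comm a b) ⟩
    (b ∧ a) ∧ c ≡⟨ ∧-assoc b a c ⟩
    b ∧ a ∧ c   ∎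
    where
      open ≡-Reasoning
      a = not (i =ᶠ k)
      b = not (i =ᶠ j)
      c = not (j =ᶠ k)

  module _ (p : Fin n → Fin n → Fin n → Bool)
           (p-swap₁₂ : ∀ i j k → p i j k ≡ p j i k)
           (p-swap₂₃ : ∀ i j k → p i j k ≡ p i k j) where

    private
      sorted : Fin n → Fin n → Fin n → ℕ
      sorted i j k = [ (i <ᶠ j) ∧ (j <ᶠ k) ∧ p i j k ]

    [p]*[distinct]≡symmetrize : ∀ i j k → [ p i j k ] * [ distinct i j k ] ≡ symmetrize sorted i j k
    [p]*[distinct]≡symmetrize i j k =
      trans (cong ([ p i j k ] *_) ([distinctᵇ]≡Σsorted (toℕ i) (toℕ j) (toℕ k)))
      (trans (*-distrib₆ [ p i j k ] (s i j k) (s i k j) (s j i k) (s j k i) (s k i j) (s k j i))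
      (cong₂ _+_ (cong₂ _+_
        (cong₂ _+_ (term i j k refl) (term i k j (sym (p-swap₂₃ i j k))))
        (cong₂ _+_ (term j i k (p-swap₁₂ j i k)) (term j k i (trans (p-swap₂₃ j k i) (p-swap₁₂ j i k)))))
        (cong₂ _+_ (term k i j (trans (p-swap₁₂ k i j) (p-swap₂₃ i k j)))
                   (term k j i (trans (p-swap₁₂ k j i) (trans (p-swap₂₃ j k i) (p-swap₁₂ j i k)))))))
      where
        *-distrib₆ : ∀ x a b c d e f →
          x * (a + b + c + d + e + f) ≡ (a * x + b * x) + (c * x + d * x) + (e * x + f * x)
        *-distrib₆ = solve-∀
        s : Fin n → Fin n → Fin n → ℕ
        s x y z = [ (x <ᶠ y) ∧ (y <ᶠ z) ]
        term : ∀ x y z → p x y z ≡ p i j k → s x y z * [ p i j k ] ≡ sorted x y z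
        term x y z p≡ = begin
          s x y z * [ p i j k ]               ≡⟨ cong (λ b → s x y z * [ b ]) (sym p≡) ⟩
          s x y z * [ p x y z ]               ≡⟨ sym ([∧]≡[]*[] ((x <ᶠ y) ∧ (y <ᶠ z)) (p x y z)) ⟩
          [ ((x <ᶠ y) ∧ (y <ᶠ z)) ∧ p x y z ] ≡⟨ cong [_] (∧-assoc (x <ᶠ y) (y <ᶠ z) (p x y z)) ⟩
          sorted x y z                        ∎
          where open ≡-Reasoning

    Σ3-distinct≡6*ΣTriples : Σ3 (λ i j k → [ p i j k ] * [ distinct i j k ]) ≡ 6 * ΣTriples p
    Σ3-distinct≡6*ΣTriples = trans (Σ3-cong [p]*[distinct]≡symmetrize) (Σ3-symmetrize sorted)

open Triples

module _ {n : ℕ} where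

  anyV⁺ : (p : Fin n → Bool) (i : Fin n) → T (p i) → T (anyV p)
  anyV⁺ p i t = any⁺ p (lose (∈-allFin i) t)

  anyV⁻ : (p : Fin n → Bool) → T (anyV p) → ∃[ i ] T (p i)
  anyV⁻ p t = satisfied (any⁻ p (allFin n) t)

  module _ {B : Fin n → Fin n → Bool} where

    dist≤2-refl : ∀ x → T (dist≤2 B x x)
    dist≤2-refl x = T-∨⁺ (inj₁ (T-=ᶠ-refl x))

    dist≤2-edge : ∀ x y → T (B x y) → T (dist≤2 B x y)
    dist≤2-edge x y t = T-∨⁺ {x =ᶠ y} (inj₂ (T-∨⁺ (inj₁ t)))

    dist≤2-path : ∀ x u y → T (B x u) → T (B u y) → T (dist≤2 B x y)
    dist≤2-path x u y t₁ t₂ =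
      T-∨⁺ {x =ᶠ y} (inj₂ (T-∨⁺ {B x y} (inj₂ (anyV⁺ (λ u → B x u ∧ B u y) u (T-∧⁺ t₁ t₂)))))

    dist≤2-cases : ∀ x y → T (dist≤2 B x y) → x ≡ y ⊎ T (B x y) ⊎ ∃[ u ] (T (B x u) × T (B u y))
    dist≤2-cases x y t with T-∨⁻ {x =ᶠ y} t
    ... | inj₁ x=y = inj₁ (T-=ᶠ⇒≡ x=y)
    ... | inj₂ t′ with T-∨⁻ {B x y} t′
    ...   | inj₁ x~y = inj₂ (inj₁ x~y)
    ...   | inj₂ ∃u with anyV⁻ (λ u → B x u ∧ B u y) ∃u
    ...     | u , t″ = inj₂ (inj₂ (u , T-∧⁻ t″))

module Counts {n : ℕ} (G : Graph n) where

  private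
    A = adj G
    A-sym = Graph.sym G

  adj⇒≢ : ∀ {x y} → T (A x y) → ¬ x ≡ y
  adj⇒≢ {x} t refl = subst T (Graph.irrefl G x) t

  adjacentPairs cherries edgeTriples : ℕ
  adjacentPairs = ΣV λ a → ΣV λ b → [ A a b ]
  cherries      = Σ3 λ v a b → [ A v a ] * [ A v b ] * [ distinct v a b ]
  edgeTriples   = Σ3 λ v a b → [ A a b ] * [ distinct v a b ]

  hasEdges : ℕ → Fin n → Fin n → Fin n → ℕ
  hasEdges k v a b = [ triEdges G v a b ≡ᵇ k ] * [ distinct v a b ]

  -- 6|T_k|
  triples : ℕ → ℕ
  triples k = Σ3 (hasEdges k)

  adjacentPairs≡2*edgeCount : adjacentPairs ≡ 2 * edgeCount G
  adjacentPairs≡2*edgeCount = begin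
    adjacentPairs
      ≡⟨ ΣV-cong (λ a → trans (ΣV-cong (oriented a))
                              (ΣV-distrib-+ (λ b → [ (a <ᶠ b) ∧ A a b ]) (λ b → [ (b <ᶠ a) ∧ A b a ]))) ⟩
    ΣV (λ a → ΣV (λ b → [ (a <ᶠ b) ∧ A a b ]) + ΣV (λ b → [ (b <ᶠ a) ∧ A b a ]))
      ≡⟨ ΣV-distrib-+ (λ a → ΣV (λ b → [ (a <ᶠ b) ∧ A a b ])) (λ a → ΣV (λ b → [ (b <ᶠ a) ∧ A b a ])) ⟩
    edgeCount G + ΣV (λ a → ΣV (λ b → [ (b <ᶠ a) ∧ A b a ]))
      ≡⟨ cong (edgeCount G +_) (ΣV-comm (λ a b → [ (b <ᶠ a) ∧ A b a ])) ⟩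
    edgeCount G + edgeCount G
      ≡⟨ double (edgeCount G) ⟩
    2 * edgeCount G ∎
    where
      open ≡-Reasoning
      double : ∀ x → x + x ≡ 2 * x
      double = solve-∀
      [adj]≡[≢]*[adj] : ∀ a b → [ A a b ] ≡ [ not (a =ᶠ b) ] * [ A a b ]
      [adj]≡[≢]*[adj] a b with A a b in eq
      ... | false = sym (*-zeroʳ [ not (a =ᶠ b) ])
      ... | true  rewrite ≢⇒=ᶠ-false (adj⇒≢ (subst T (sym eq) _)) = refl
      oriented : ∀ a b → [ A a b ] ≡ [ (a <ᶠ b) ∧ A a b ] + [ (b <ᶠ a) ∧ A b a ]
      oriented a b = begin
        [ A a b ]                                     ≡⟨ [adj]≡[≢]*[adj] a b ⟩
        [ not (a =ᶠ b) ] * [ A a b ]                  ≡⟨ cong (_* [ A a b ]) ([≢ᵇ]≡[<ᵇ]+[>ᵇ] (toℕ a) (toℕ b)) ⟩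
        ([ a <ᶠ b ] + [ b <ᶠ a ]) * [ A a b ]         ≡⟨ *-distribʳ-+ [ A a b ] [ a <ᶠ b ] [ b <ᶠ a ] ⟩
        [ a <ᶠ b ] * [ A a b ] + [ b <ᶠ a ] * [ A a b ] ≡⟨ sym (cong₂ _+_ ([∧]≡[]*[] (a <ᶠ b) (A a b))
                                                          (trans ([∧]≡[]*[] (b <ᶠ a) (A b a))
                                                                 (cong (λ x → [ b <ᶠ a ] * [ x ]) (A-sym b a)))) ⟩
        [ (a <ᶠ b) ∧ A a b ] + [ (b <ᶠ a) ∧ A b a ]   ∎

  sumDegSq≡adjacentPairs+cherries : sumDegSq G ≡ adjacentPairs + cherries
  sumDegSq≡adjacentPairs+cherries = begin
    sumDegSq G
      ≡⟨ ΣV-cong degree² ⟩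
    ΣV (λ v → ΣV (λ a → [ A v a ]) + ΣV (λ a → ΣV (λ b → c v a b)))
      ≡⟨ ΣV-distrib-+ (λ v → ΣV (λ a → [ A v a ])) (λ v → ΣV (λ a → ΣV (λ b → c v a b))) ⟩
    adjacentPairs + cherries ∎
    where
      open ≡-Reasoning
      c : Fin n → Fin n → Fin n → ℕ
      c v a b = [ A v a ] * [ A v b ] * [ distinct v a b ]
      split : ∀ v a b → [ A v a ] * [ A v b ] ≡ [ a =ᶠ b ] * [ A v b ] + c v a b
      split v a b = []*[]≡diagonal+distinct (A v a) (A v b) (a =ᶠ b) (v =ᶠ a) (v =ᶠ b)
        (λ t → cong (A v) (T-=ᶠ⇒≡ t)) (λ t → ≢⇒=ᶠ-false (adj⇒≢ t)) (λ t → ≢⇒=ᶠ-false (adj⇒≢ t))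
      degree² : ∀ v → degree G v * degree G v ≡ ΣV (λ a → [ A v a ]) + ΣV (λ a → ΣV (λ b → c v a b))
      degree² v = begin
        degree G v * degree G v
          ≡⟨ sym (ΣV-*ʳ (degree G v) (λ a → [ A v a ])) ⟩
        ΣV (λ a → [ A v a ] * degree G v)
          ≡⟨ ΣV-cong (λ a → sym (ΣV-*ˡ [ A v a ] (λ b → [ A v b ]))) ⟩
        ΣV (λ a → ΣV (λ b → [ A v a ] * [ A v b ]))
          ≡⟨ ΣV-cong (λ a → trans (ΣV-cong (split v a)) (ΣV-distrib-+ (λ b → [ a =ᶠ b ] * [ A v b ]) (c v a))) ⟩
        ΣV (λ a → ΣV (λ b → [ a =ᶠ b ] * [ A v b ]) + ΣV (c v a))
          ≡⟨ ΣV-distrib-+ (λ a → ΣV (λ b → [ a =ᶠ b ] * [ A v b ])) (λ a → ΣV (c v a)) ⟩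
        ΣV (λ a → ΣV (λ b → [ a =ᶠ b ] * [ A v b ])) + ΣV (λ a → ΣV (c v a))
          ≡⟨ cong (_+ ΣV (λ a → ΣV (c v a))) (ΣV-cong (λ a → ΣV-[=ᶠ]* a (λ b → [ A v b ]))) ⟩
        ΣV (λ a → [ A v a ]) + ΣV (λ a → ΣV (c v a)) ∎

  n*adjacentPairs≡2*adjacentPairs+edgeTriples : n * adjacentPairs ≡ 2 * adjacentPairs + edgeTriples
  n*adjacentPairs≡2*adjacentPairs+edgeTriples = begin
    n * adjacentPairs
      ≡⟨ sym (ΣV-const {n} adjacentPairs) ⟩
    Σ3 (λ v a b → [ A a b ])
      ≡⟨ Σ3-cong split ⟩
    Σ3 (λ v a b → at-v v a b + at-v v b a + [ A a b ] * [ distinct v a b ])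
      ≡⟨ trans (Σ3-distrib-+ (λ v a b → at-v v a b + at-v v b a) (λ v a b → [ A a b ] * [ distinct v a b ]))
               (cong (_+ edgeTriples) (Σ3-distrib-+ at-v (λ v a b → at-v v b a))) ⟩
    Σ3 at-v + Σ3 (λ v a b → at-v v b a) + edgeTriples
      ≡⟨ cong (λ x → Σ3 at-v + x + edgeTriples) (sym (Σ3-swap₂₃ at-v)) ⟩
    Σ3 at-v + Σ3 at-v + edgeTriples
      ≡⟨ cong (λ x → x + x + edgeTriples) Σ3-at-v ⟩
    adjacentPairs + adjacentPairs + edgeTriples
      ≡⟨ cong (_+ edgeTriples) (double adjacentPairs) ⟩
    2 * adjacentPairs + edgeTriples ∎
    where
      open ≡-Reasoning
      at-v : Fin n → Fin n → Fin n → ℕ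
      at-v v a b = [ v =ᶠ a ] * [ A a b ]
      split : ∀ v a b → [ A a b ] ≡ at-v v a b + at-v v b a + [ A a b ] * [ distinct v a b ]
      split v a b = trans ([]≡ends+distinct (A a b) (a =ᶠ b) (v =ᶠ a) (v =ᶠ b) (λ t → ≢⇒=ᶠ-false (adj⇒≢ t))
        (λ t v=a → ≢⇒=ᶠ-false (λ v≡b → adj⇒≢ t (trans (sym (T-=ᶠ⇒≡ {i = v} {j = a} v=a)) v≡b))))
        (cong (λ x → at-v v a b + [ v =ᶠ b ] * [ x ] + [ A a b ] * [ distinct v a b ]) (A-sym a b))
      double : ∀ x → x + x ≡ 2 * x
      double = solve-∀
      Σ3-at-v : Σ3 at-v ≡ adjacentPairs
      Σ3-at-v = ΣV-cong λ v → trans (ΣV-cong λ a → ΣV-*ˡ [ v =ᶠ a ] (λ b → [ A a b ]))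
                                    (ΣV-[=ᶠ]* v (λ a → ΣV (λ b → [ A a b ])))

  cherries-by-class : 3 * cherries ≡ triples 2 + 3 * triples 3
  cherries-by-class = begin
    3 * cherries                         ≡⟨ triple cherries ⟩
    cherries + cherries + cherries       ≡⟨ cong₂ (λ x y → cherries + x + y) at-a at-b ⟩
    Σ3 c + Σ3 c-a + Σ3 c-b               ≡⟨ sym (trans (Σ3-distrib-+ _ c-b) (cong (_+ Σ3 c-b) (Σ3-distrib-+ c c-a))) ⟩
    Σ3 (λ v a b → c v a b + c-a v a b + c-b v a b)
      ≡⟨ Σ3-cong pointwise ⟩
    Σ3 (λ v a b → hasEdges 2 v a b + 3 * hasEdges 3 v a b)
      ≡⟨ trans (Σ3-distrib-+ (hasEdges 2) (λ v a b → 3 * hasEdges 3 v a b))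
               (cong (triples 2 +_) (Σ3-*ˡ 3 (hasEdges 3))) ⟩
    triples 2 + 3 * triples 3            ∎
    where
      open ≡-Reasoning
      c c-a c-b : Fin n → Fin n → Fin n → ℕ
      c   v a b = [ A v a ] * [ A v b ] * [ distinct v a b ]
      c-a v a b = [ A v a ] * [ A a b ] * [ distinct v a b ]
      c-b v a b = [ A v b ] * [ A a b ] * [ distinct v a b ]
      triple : ∀ x → 3 * x ≡ x + x + x
      triple = solve-∀
      at-a : cherries ≡ Σ3 c-a
      at-a = sym (trans (Σ3-swap₁₂ c-a) (Σ3-cong λ v a b →
        cong₂ (λ x y → [ x ] * [ A v b ] * [ y ]) (A-sym a v) (distinct-swap₁₂ v a b)))
      at-b : cherries ≡ Σ3 c-b
      at-b = sym (trans (Σ3-rotate c-b) (Σ3-cong λ v a b →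
        trans (cong₂ (λ x y → [ x ] * [ y ] * [ distinct a b v ]) (A-sym a v) (A-sym b v))
              (cong (λ z → [ A v a ] * [ A v b ] * [ z ]) (trans (distinct-swap₂₃ a v b) (distinct-swap₁₂ v a b)))))
      pointwise : ∀ v a b → c v a b + c-a v a b + c-b v a b ≡ hasEdges 2 v a b + 3 * hasEdges 3 v a b
      pointwise v a b = trans (distrib [ A v a ] [ A v b ] [ A a b ] _)
        (trans (cong (_* [ distinct v a b ]) (pairs-by-class (A v a) (A v b) (A a b)))
               (distrib′ [ triEdges G v a b ≡ᵇ 2 ] [ triEdges G v a b ≡ᵇ 3 ] _))
        where
          distrib : ∀ p q r d → p * q * d + p * r * d + q * r * d ≡ (p * q + p * r + q * r) * d
          distrib = solve-∀
          distrib′ : ∀ x y d → (x + 3 * y) * d ≡ x * d + 3 * (y * d)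
          distrib′ = solve-∀

  edgeTriples-by-class : 3 * edgeTriples ≡ triples 1 + 2 * triples 2 + 3 * triples 3
  edgeTriples-by-class = begin
    3 * edgeTriples                               ≡⟨ triple edgeTriples ⟩
    edgeTriples + edgeTriples + edgeTriples       ≡⟨ cong₂ (λ x y → x + y + edgeTriples) at-va at-vb ⟩
    Σ3 q-va + Σ3 q-vb + Σ3 q                      ≡⟨ sym (trans (Σ3-distrib-+ (λ v a b → q-va v a b + q-vb v a b) q)
                                                                (cong (_+ Σ3 q) (Σ3-distrib-+ q-va q-vb))) ⟩
    Σ3 (λ v a b → q-va v a b + q-vb v a b + q v a b)
      ≡⟨ Σ3-cong pointwise ⟩
    Σ3 (λ v a b → hasEdges 1 v a b + 2 * hasEdges 2 v a b + 3 * hasEdges 3 v a b)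
      ≡⟨ Σ3-distrib-+ (λ v a b → hasEdges 1 v a b + 2 * hasEdges 2 v a b) (λ v a b → 3 * hasEdges 3 v a b) ⟩
    Σ3 (λ v a b → hasEdges 1 v a b + 2 * hasEdges 2 v a b) + Σ3 (λ v a b → 3 * hasEdges 3 v a b)
      ≡⟨ cong₂ _+_ (trans (Σ3-distrib-+ (hasEdges 1) (λ v a b → 2 * hasEdges 2 v a b))
                          (cong (triples 1 +_) (Σ3-*ˡ 2 (hasEdges 2))))
                   (Σ3-*ˡ 3 (hasEdges 3)) ⟩
    triples 1 + 2 * triples 2 + 3 * triples 3     ∎
    where
      open ≡-Reasoning
      q q-va q-vb : Fin n → Fin n → Fin n → ℕ
      q    v a b = [ A a b ] * [ distinct v a b ]
      q-va v a b = [ A v a ] * [ distinct v a b ]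
      q-vb v a b = [ A v b ] * [ distinct v a b ]
      triple : ∀ x → 3 * x ≡ x + x + x
      triple = solve-∀
      at-va : edgeTriples ≡ Σ3 q-va
      at-va = sym (trans (Σ3-rotate q-va) (Σ3-cong λ v a b →
        cong (λ z → [ A a b ] * [ z ]) (trans (distinct-swap₂₃ a v b) (distinct-swap₁₂ v a b))))
      at-vb : edgeTriples ≡ Σ3 q-vb
      at-vb = sym (trans (Σ3-swap₁₂ q-vb) (Σ3-cong λ v a b →
        cong (λ z → [ A a b ] * [ z ]) (distinct-swap₁₂ v a b)))
      pointwise : ∀ v a b → q-va v a b + q-vb v a b + q v a b ≡
        hasEdges 1 v a b + 2 * hasEdges 2 v a b + 3 * hasEdges 3 v a b
      pointwise v a b = trans (distrib [ A v a ] [ A v b ] [ A a b ] [ distinct v a b ])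
        (trans (cong (_* [ distinct v a b ]) (edges-by-class (A v a) (A v b) (A a b)))
               (distrib′ [ triEdges G v a b ≡ᵇ 1 ] [ triEdges G v a b ≡ᵇ 2 ] [ triEdges G v a b ≡ᵇ 3 ]
                         [ distinct v a b ]))
        where
          distrib : ∀ p q r d → p * d + q * d + r * d ≡ (p + q + r) * d
          distrib = solve-∀
          distrib′ : ∀ x y z d → (x + 2 * y + 3 * z) * d ≡ x * d + 2 * (y * d) + 3 * (z * d)
          distrib′ = solve-∀

  triEdges-swap₁₂ : ∀ i j k → triEdges G i j k ≡ triEdges G j i k
  triEdges-swap₁₂ i j k rewrite A-sym j i = swap [ A i j ] [ A i k ] [ A j k ]
    where
      swap : ∀ x y z → x + y + z ≡ x + z + y
      swap = solve-∀

  triEdges-swap₂₃ : ∀ i j k → triEdges G i j k ≡ triEdges G i k j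
  triEdges-swap₂₃ i j k rewrite A-sym k j = swap [ A i j ] [ A i k ] [ A j k ]
    where
      swap : ∀ x y z → x + y + z ≡ y + x + z
      swap = solve-∀

  triples₂≡6*countT2 : triples 2 ≡ 6 * countT2 G
  triples₂≡6*countT2 = Σ3-distinct≡6*ΣTriples (λ i j k → triEdges G i j k ≡ᵇ 2)
    (λ i j k → cong (_≡ᵇ 2) (triEdges-swap₁₂ i j k)) (λ i j k → cong (_≡ᵇ 2) (triEdges-swap₂₃ i j k))

module Feet {n : ℕ} (G : Graph n) (S : PathSelection G) where

  open import Data.Nat using (_≤_; z≤n; s≤s)
  open import Data.Nat.Properties using (≤-refl; *-monoʳ-≤; module ≤-Reasoning)
  open import Data.Bool.Solver using (module ∨-∧-Solver)
  open ∨-∧-Solver using (solve; _:+_; _:=_)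
  open Counts G using (adj⇒≢; hasEdges; triples; triEdges-swap₁₂; triEdges-swap₂₃)

  -- records rather than T-valued predicates, so that their vertex arguments can be inferred
  infix 4 _~_
  record _~_ (x y : Fin n) : Set where
    constructor adjacent
    field edge : T (adj G x y)
  open _~_

  ~-sym : ∀ {x y} → x ~ y → y ~ x
  ~-sym {x} {y} (adjacent e) = adjacent (subst T (Graph.sym G x y) e)

  ~⇒≢ : ∀ {x y} → x ~ y → ¬ x ≡ y
  ~⇒≢ (adjacent e) = adj⇒≢ e

  ~⇒≢′ : ∀ {x y} → x ~ y → ¬ y ≡ x
  ~⇒≢′ x~y y≡x = ~⇒≢ x~y (sym y≡x)

  Triangle : Fin n → Fin n → Fin n → Set
  Triangle a b c = a ~ b × a ~ c × b ~ c

  Triangle-swap₁₂ : ∀ {a b c} → Triangle a b c → Triangle b a c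
  Triangle-swap₁₂ (ab , ac , bc) = ~-sym ab , bc , ac

  Triangle-swap₂₃ : ∀ {a b c} → Triangle a b c → Triangle a c b
  Triangle-swap₂₃ (ab , ac , bc) = ac , ab , ~-sym bc

  record Survives (a b u v : Fin n) : Set where
    constructor surviving
    field edge : T (delEdge (adj G) a b u v)

  record Close (a b x y : Fin n) : Set where
    constructor close
    field within : T (dist≤2 (delEdge (adj G) a b) x y)

  Far : Fin n → Fin n → Fin n → Fin n → Set
  Far a b x y = ¬ Close a b x y

  survives : ∀ {a b u v} → u ~ v → ¬ u ≡ a → ¬ u ≡ b → Survives a b u v
  survives {a} {b} {u} {v} (adjacent e) u≢a u≢b = surviving kept
    where
      kept : T (delEdge (adj G) a b u v)
      kept rewrite ≢⇒=ᶠ-false u≢a | ≢⇒=ᶠ-false u≢b = T-∧⁺ e _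

  Survives-sym : ∀ {a b u v} → Survives a b u v → Survives a b v u
  Survives-sym {a} {b} {u} {v} (surviving t) with T-∧⁻ {adj G u v} t
  ... | e , kept = surviving (T-∧⁺ (edge (~-sym (adjacent e))) (subst (λ d → T (not d)) swapped kept))
    where
      swapped : ((u =ᶠ a) ∧ (v =ᶠ b)) ∨ ((u =ᶠ b) ∧ (v =ᶠ a)) ≡ ((v =ᶠ a) ∧ (u =ᶠ b)) ∨ ((v =ᶠ b) ∧ (u =ᶠ a))
      swapped = trans (∨-comm ((u =ᶠ a) ∧ (v =ᶠ b)) ((u =ᶠ b) ∧ (v =ᶠ a)))
                      (cong₂ _∨_ (∧-comm (u =ᶠ b) (v =ᶠ a)) (∧-comm (u =ᶠ a) (v =ᶠ b)))

  Survives-swap : ∀ {a b u v} → Survives a b u v → Survives b a u v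
  Survives-swap {a} {b} {u} {v} (surviving t) =
    surviving (subst (λ d → T (adj G u v ∧ not d)) (∨-comm ((u =ᶠ a) ∧ (v =ᶠ b)) ((u =ᶠ b) ∧ (v =ᶠ a))) t)

  survives′ : ∀ {a b u v} → u ~ v → ¬ v ≡ a → ¬ v ≡ b → Survives a b u v
  survives′ u~v v≢a v≢b = Survives-sym (survives (~-sym u~v) v≢a v≢b)

  destroyed : ∀ {a b u v} → u ~ v → ¬ Survives a b u v → (u ≡ a × v ≡ b) ⊎ (u ≡ b × v ≡ a)
  destroyed {a} {b} {u} {v} u~v gone with u ≟ a | u ≟ b | v ≟ a | v ≟ b
  ... | yes u≡a  | _        | _        | yes v≡b  = inj₁ (u≡a , v≡b)
  ... | _        | yes u≡b  | yes v≡a  | _        = inj₂ (u≡b , v≡a)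
  ... | no u≢a   | no u≢b   | _        | _        = ⊥-elim (gone (survives u~v u≢a u≢b))
  ... | _        | _        | no v≢a   | no v≢b   = ⊥-elim (gone (survives′ u~v v≢a v≢b))
  ... | yes refl | _        | yes refl | no _     = ⊥-elim (~⇒≢ u~v refl)
  ... | no _     | yes refl | no _     | yes refl = ⊥-elim (~⇒≢ u~v refl)

  Close-refl : ∀ {a b x} → Close a b x x
  Close-refl {a} {b} {x} = close (dist≤2-refl {B = delEdge (adj G) a b} x)

  Close-edge : ∀ {a b x y} → Survives a b x y → Close a b x y
  Close-edge {a} {b} {x} {y} (surviving e) = close (dist≤2-edge {B = delEdge (adj G) a b} x y e)

  Close-path : ∀ {a b x y} u → Survives a b x u → Survives a b u y → Close a b x y
  Close-path {a} {b} {x} {y} u (surviving e₁) (surviving e₂) =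
    close (dist≤2-path {B = delEdge (adj G) a b} x u y e₁ e₂)

  Far-sym : ∀ {a b x y} → Far a b x y → Far a b y x
  Far-sym {a} {b} {x} {y} far (close t) with dist≤2-cases {B = delEdge (adj G) a b} y x t
  ... | inj₁ refl                 = far Close-refl
  ... | inj₂ (inj₁ e)             = far (Close-edge (Survives-sym (surviving e)))
  ... | inj₂ (inj₂ (u , e₁ , e₂)) = far (Close-path u (Survives-sym (surviving e₂)) (Survives-sym (surviving e₁)))

  Far-swap : ∀ {a b x y} → Far a b x y → Far b a x y
  Far-swap {a} {b} {x} {y} far (close t) with dist≤2-cases {B = delEdge (adj G) b a} x y t
  ... | inj₁ refl                 = far Close-refl
  ... | inj₂ (inj₁ e)             = far (Close-edge (Survives-swap (surviving e)))
  ... | inj₂ (inj₂ (u , e₁ , e₂)) = far (Close-path u (Survives-swap (surviving e₁)) (Survives-swap (surviving e₂)))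

  record UniqueMiddle (w x y : Fin n) : Set where
    field
      to-middle  : w ~ x
      not-to-end : ¬ w ~ y
      unique     : ∀ {u} → w ~ u → u ~ y → u ≡ x

  selected⇒UniqueMiddle : ∀ {w x y} → T (pathInP S w x y) → UniqueMiddle w x y
  selected⇒UniqueMiddle {w} {x} {y} t
    with T-∧⁻ {not (w =ᶠ y)} t
  ... | w≠y , t₁ with T-∧⁻ {not (adj G w y)} t₁
  ... | w≁y , t₂ with T-∧⁻ {critical G w y} t₂
  ... | crit , t₃ with T-∧⁻ {mid S w y =ᶠ x} t₃
  ... | mid=x , assoc = record { to-middle = w~x ; not-to-end = λ (adjacent e) → T-not⁻ w≁y e ; unique = unique′ }
    where
      w~x : w ~ x
      w~x = adjacent (subst (λ m → T (adj G w m)) (T-=ᶠ⇒≡ mid=x) (proj₁ (mid-adj S w y crit w≁y)))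
      far : Far x y w y
      far (close c) = T-not⁻ (proj₂ (T-∧⁻ {dist≤2 (adj G) w y} (proj₂ (T-∧⁻ {adj G x y} assoc)))) c
      w≢y : ¬ w ≡ y
      w≢y refl = T-not⁻ w≠y (T-=ᶠ-refl w)
      unique′ : ∀ {u} → w ~ u → u ~ y → u ≡ x
      unique′ {u} w~u u~y with u ≟ x
      ... | yes u≡x = u≡x
      ... | no  u≢x = ⊥-elim (far (Close-path u (survives w~u (~⇒≢ w~x) w≢y) (survives u~y u≢x (~⇒≢ u~y))))

  open UniqueMiddle

  OneOf : Fin n → Fin n → Fin n → Fin n → Set
  OneOf u a b c = u ≡ a ⊎ u ≡ b ⊎ u ≡ c

  Triangle-adjacent : ∀ {a b c u v} → Triangle a b c → OneOf u a b c → OneOf v a b c → ¬ u ≡ v → u ~ v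
  Triangle-adjacent _              (inj₁ refl)        (inj₁ refl)        u≢v = ⊥-elim (u≢v refl)
  Triangle-adjacent (ab , ac , bc) (inj₁ refl)        (inj₂ (inj₁ refl)) _   = ab
  Triangle-adjacent (ab , ac , bc) (inj₁ refl)        (inj₂ (inj₂ refl)) _   = ac
  Triangle-adjacent (ab , ac , bc) (inj₂ (inj₁ refl)) (inj₁ refl)        _   = ~-sym ab
  Triangle-adjacent _              (inj₂ (inj₁ refl)) (inj₂ (inj₁ refl)) u≢v = ⊥-elim (u≢v refl)
  Triangle-adjacent (ab , ac , bc) (inj₂ (inj₁ refl)) (inj₂ (inj₂ refl)) _   = bc
  Triangle-adjacent (ab , ac , bc) (inj₂ (inj₂ refl)) (inj₁ refl)        _   = ~-sym ac
  Triangle-adjacent (ab , ac , bc) (inj₂ (inj₂ refl)) (inj₂ (inj₁ refl)) _   = ~-sym bc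
  Triangle-adjacent _              (inj₂ (inj₂ refl)) (inj₂ (inj₂ refl)) u≢v = ⊥-elim (u≢v refl)

  record Foot (w a b c : Fin n) : Set where
    field
      x y    : Fin n
      x∈     : OneOf x a b c
      y∈     : OneOf y a b c
      middle : UniqueMiddle w x y
  open Foot

  foot-neighbour : ∀ {w a b c u} → Triangle a b c → (F : Foot w a b c) → OneOf u a b c → w ~ u → u ≡ x F
  foot-neighbour {u = u} t F u∈ w~u with u ≟ y F
  ... | yes refl = ⊥-elim (not-to-end (middle F) w~u)
  ... | no  u≢y  = unique (middle F) w~u (Triangle-adjacent t u∈ (y∈ F) u≢y)

  foot-neighbours-equal : ∀ {w a b c u v} → Triangle a b c → Foot w a b c →
    OneOf u a b c → adj G w u ≡ true → OneOf v a b c → adj G w v ≡ true → u ≡ v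
  foot-neighbours-equal t F u∈ wu v∈ wv =
    trans (foot-neighbour t F u∈ (adjacent (subst T (sym wu) _)))
          (sym (foot-neighbour t F v∈ (adjacent (subst T (sym wv) _))))

  foot-adjacency-count : ∀ {w a b c} → Triangle a b c → Foot w a b c →
    [ adj G w a ] + [ adj G w b ] + [ adj G w c ] ≡ 1
  foot-adjacency-count {w} {a} {b} {c} t@(ab , ac , bc) F
    with adj G w a in wa | adj G w b in wb | adj G w c in wc
  ... | true  | true  | _     = ⊥-elim (~⇒≢ ab (foot-neighbours-equal t F (inj₁ refl) wa (inj₂ (inj₁ refl)) wb))
  ... | true  | false | true  = ⊥-elim (~⇒≢ ac (foot-neighbours-equal t F (inj₁ refl) wa (inj₂ (inj₂ refl)) wc))
  ... | false | true  | true  = ⊥-elim (~⇒≢ bc (foot-neighbours-equal t F (inj₂ (inj₁ refl)) wb (inj₂ (inj₂ refl)) wc))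
  ... | true  | false | false = refl
  ... | false | true  | false = refl
  ... | false | false | true  = refl
  ... | false | false | false = ⊥-elim (none (x∈ F) (to-middle (middle F)))
    where
      none : ∀ {u} → OneOf u a b c → ¬ w ~ u
      none (inj₁ refl)        (adjacent e) = subst T wa e
      none (inj₂ (inj₁ refl)) (adjacent e) = subst T wb e
      none (inj₂ (inj₂ refl)) (adjacent e) = subst T wc e

  foot-injective : ∀ {w x x′ a b} → Triangle x a b → Triangle x′ a b → (F : Foot w x a b) →
    w ~ x → w ~ x′ → x ≡ x′
  foot-injective t (x′a , x′b , _) F w~x w~x′ =
    trans (foot-neighbour t F (inj₁ refl) w~x) (sym (unique (middle F) w~x′ (x′~end (y∈ F))))
    where
      x′~end : OneOf (y F) _ _ _ → _ ~ y F
      x′~end (inj₁ refl)        = ⊥-elim (not-to-end (middle F) w~x)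
      x′~end (inj₂ (inj₁ refl)) = x′a
      x′~end (inj₂ (inj₂ refl)) = x′b

  Outside : Fin n → Fin n → Fin n → Fin n → Set
  Outside w a b c = ¬ w ≡ a × ¬ w ≡ b × ¬ w ≡ c

  private
    P : Fin n → Fin n → Fin n → Bool
    P = pathInP S

  isFoot⁺ : ∀ {w a b c} → Outside w a b c → T (P w a b) ⊎ T (P w b a) → T (isFoot S a b c w)
  isFoot⁺ {w} {a} {b} {c} (w≢a , w≢b , w≢c) path = T-∧⁺ outside (T-∨⁺ (map₂ (λ p → T-∨⁺ (inj₁ p)) path))
    where
      outside : T (not ((w =ᶠ a) ∨ (w =ᶠ b) ∨ (w =ᶠ c)))
      outside rewrite ≢⇒=ᶠ-false w≢a | ≢⇒=ᶠ-false w≢b | ≢⇒=ᶠ-false w≢c = _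

  isFoot⁻ : ∀ {w a b c} → T (isFoot S a b c w) → Outside w a b c × Foot w a b c
  isFoot⁻ {w} {a} {b} {c} t with T-∧⁻ {not ((w =ᶠ a) ∨ (w =ᶠ b) ∨ (w =ᶠ c))} t
  ... | outside , paths = (w≢ a inˡ , w≢ b inᵐ , w≢ c inʳ) , foot paths
    where
      w≢ : ∀ u → (T (w =ᶠ u) → T ((w =ᶠ a) ∨ (w =ᶠ b) ∨ (w =ᶠ c))) → ¬ w ≡ u
      w≢ u into refl = T-not⁻ outside (into (T-=ᶠ-refl w))
      inˡ : T (w =ᶠ a) → T ((w =ᶠ a) ∨ (w =ᶠ b) ∨ (w =ᶠ c))
      inˡ e = T-∨⁺ (inj₁ e)
      inᵐ : T (w =ᶠ b) → T ((w =ᶠ a) ∨ (w =ᶠ b) ∨ (w =ᶠ c))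
      inᵐ e = T-∨⁺ {w =ᶠ a} (inj₂ (T-∨⁺ (inj₁ e)))
      inʳ : T (w =ᶠ c) → T ((w =ᶠ a) ∨ (w =ᶠ b) ∨ (w =ᶠ c))
      inʳ e = T-∨⁺ {w =ᶠ a} (inj₂ (T-∨⁺ {w =ᶠ b} (inj₂ e)))
      a∈ : OneOf a a b c
      a∈ = inj₁ refl
      b∈ : OneOf b a b c
      b∈ = inj₂ (inj₁ refl)
      c∈ : OneOf c a b c
      c∈ = inj₂ (inj₂ refl)
      through : ∀ {x y} → OneOf x a b c → OneOf y a b c → T (P w x y) → Foot w a b c
      through x∈ y∈ p = record { x∈ = x∈ ; y∈ = y∈ ; middle = selected⇒UniqueMiddle p }
      foot : T (P w a b ∨ P w b a ∨ P w a c ∨ P w c a ∨ P w b c ∨ P w c b) → Foot w a b c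
      foot t₁ with T-∨⁻ {P w a b} t₁
      ... | inj₁ p = through a∈ b∈ p
      ... | inj₂ t₂ with T-∨⁻ {P w b a} t₂
      ... | inj₁ p = through b∈ a∈ p
      ... | inj₂ t₃ with T-∨⁻ {P w a c} t₃
      ... | inj₁ p = through a∈ c∈ p
      ... | inj₂ t₄ with T-∨⁻ {P w c a} t₄
      ... | inj₁ p = through c∈ a∈ p
      ... | inj₂ t₅ with T-∨⁻ {P w b c} t₅
      ... | inj₁ p = through b∈ c∈ p
      ... | inj₂ p = through c∈ b∈ p

  isFoot-swap₁₂ : ∀ a b c w → isFoot S a b c w ≡ isFoot S b a c w
  isFoot-swap₁₂ a b c w = cong₂ _∧_
    (cong not (solve 3 (λ x y z → x :+ (y :+ z) := y :+ (x :+ z)) refl (w =ᶠ a) (w =ᶠ b) (w =ᶠ c)))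
    (solve 6 (λ p₁ p₂ p₃ p₄ p₅ p₆ → p₁ :+ (p₂ :+ (p₃ :+ (p₄ :+ (p₅ :+ p₆))))
                                 := p₂ :+ (p₁ :+ (p₅ :+ (p₆ :+ (p₃ :+ p₄))))) refl
      (P w a b) (P w b a) (P w a c) (P w c a) (P w b c) (P w c b))

  isFoot-swap₂₃ : ∀ a b c w → isFoot S a b c w ≡ isFoot S a c b w
  isFoot-swap₂₃ a b c w = cong₂ _∧_
    (cong not (solve 3 (λ x y z → x :+ (y :+ z) := x :+ (z :+ y)) refl (w =ᶠ a) (w =ᶠ b) (w =ᶠ c)))
    (solve 6 (λ p₁ p₂ p₃ p₄ p₅ p₆ → p₁ :+ (p₂ :+ (p₃ :+ (p₄ :+ (p₅ :+ p₆))))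
                                 := p₃ :+ (p₄ :+ (p₁ :+ (p₂ :+ (p₆ :+ p₅))))) refl
      (P w a b) (P w b a) (P w a c) (P w c a) (P w b c) (P w c b))

  feetCount-swap₁₂ : ∀ a b c → feetCount S a b c ≡ feetCount S b a c
  feetCount-swap₁₂ a b c = ΣV-cong λ w → cong [_] (isFoot-swap₁₂ a b c w)

  feetCount-swap₂₃ : ∀ a b c → feetCount S a b c ≡ feetCount S a c b
  feetCount-swap₂₃ a b c = ΣV-cong λ w → cong [_] (isFoot-swap₂₃ a b c w)

  triEdges≡3⇒Triangle : ∀ {a b c} → T (triEdges G a b c ≡ᵇ 3) → Triangle a b c
  triEdges≡3⇒Triangle {a} {b} {c} t with adj G a b in ab | adj G a c in ac | adj G b c in bc
  ... | true  | true  | true  =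
    adjacent (subst T (sym ab) _) , adjacent (subst T (sym ac) _) , adjacent (subst T (sym bc) _)
  ... | true  | true  | false = ⊥-elim t
  ... | true  | false | true  = ⊥-elim t
  ... | true  | false | false = ⊥-elim t
  ... | false | true  | true  = ⊥-elim t
  ... | false | true  | false = ⊥-elim t
  ... | false | false | true  = ⊥-elim t
  ... | false | false | false = ⊥-elim t

  Triangle⇒distinct : ∀ {a b c} → Triangle a b c → T (distinct a b c)
  Triangle⇒distinct (ab , ac , bc) = distinct⁺ (~⇒≢ ab) (~⇒≢ ac) (~⇒≢ bc)

  two-distinct-feet : ∀ {a b c w w′} → T (isFoot S a b c w) → T (isFoot S a b c w′) → ¬ w ≡ w′ →
    2 ≤ feetCount S a b c
  two-distinct-feet {a} {b} {c} f f′ w≢w′ = subst (_≤ feetCount S a b c) (cong₂ _+_ ([T]≡1 f) ([T]≡1 f′))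
    (ΣV-pair-≤ (λ u → [ isFoot S a b c u ]) w≢w′)

  attached : Fin n → Fin n → Fin n → Fin n → ℕ
  attached x a b w = [ ((triEdges G x a b ≡ᵇ 3) ∧ isFoot S x a b w) ∧ adj G w x ]

  loneEdge : Fin n → Fin n → Fin n → ℕ
  loneEdge w a b = [ distinct w a b ∧ adj G a b ∧ not (adj G w a) ∧ not (adj G w b) ]

  ΣV-attached≤loneEdge : ∀ w a b → ΣV (λ x → attached x a b w) ≤ loneEdge w a b
  ΣV-attached≤loneEdge w a b = ΣV-[]-≤ _ _ injective lone
    where
      unpack : ∀ {x} → T (((triEdges G x a b ≡ᵇ 3) ∧ isFoot S x a b w) ∧ adj G w x) →
        Triangle x a b × Outside w x a b × Foot w x a b × w ~ x
      unpack {x} t with T-∧⁻ {(triEdges G x a b ≡ᵇ 3) ∧ isFoot S x a b w} t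
      ... | t₁ , w~x with T-∧⁻ {triEdges G x a b ≡ᵇ 3} t₁
      ... | tri , foot = triEdges≡3⇒Triangle tri , proj₁ (isFoot⁻ foot) , proj₂ (isFoot⁻ foot) , adjacent w~x
      injective : ∀ x x′ → T _ → T _ → x ≡ x′
      injective x x′ t t′ with unpack {x} t | unpack {x′} t′
      ... | tri , _ , F , w~x | tri′ , _ , _ , w~x′ = foot-injective tri tri′ F w~x w~x′
      lone : ∀ x → T _ → T (distinct w a b ∧ adj G a b ∧ not (adj G w a) ∧ not (adj G w b))
      lone x t with unpack {x} t
      ... | tri@(_ , _ , a~b) , (_ , w≢a , w≢b) , F , adjacent w~x
        with only-first (foot-adjacency-count tri F) w~x
      ... | w≁a , w≁b = T-∧⁺ (distinct⁺ w≢a w≢b (~⇒≢ a~b)) (T-∧⁺ (edge a~b) (T-∧⁺ w≁a w≁b))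

  triples₁≡3*Σ3loneEdge : triples 1 ≡ 3 * Σ3 loneEdge
  triples₁≡3*Σ3loneEdge = trans (Σ3-cong by-position) (Σ3-positions loneEdge)
    where
      by-position : ∀ v a b → hasEdges 1 v a b ≡ loneEdge v a b + loneEdge a v b + loneEdge b v a
      by-position v a b = trans (lone-by-position (adj G v a) (adj G v b) (adj G a b) (distinct v a b))
        (cong₂ (λ x y → loneEdge v a b + x + y) (sym at-a) (sym at-b))
        where
          at-a : loneEdge a v b ≡ [ distinct v a b ∧ adj G v b ∧ not (adj G v a) ∧ not (adj G a b) ]
          at-a rewrite distinct-swap₁₂ v a b | Graph.sym G a v = refl
          at-b : loneEdge b v a ≡ [ distinct v a b ∧ adj G v a ∧ not (adj G v b) ∧ not (adj G a b) ]
          at-b rewrite distinct-swap₁₂ v b a | distinct-swap₂₃ v a b | Graph.sym G b v | Graph.sym G b a = refl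

  attachedAt : Fin n → Fin n → Fin n → ℕ
  attachedAt x a b = ΣV (attached x a b)

  Σ3attachedAt≤Σ3loneEdge : Σ3 attachedAt ≤ Σ3 loneEdge
  Σ3attachedAt≤Σ3loneEdge = begin
    Σ3 attachedAt                                          ≡⟨ Σ3-ΣV-comm attached ⟩
    ΣV (λ w → Σ3 (λ x a b → attached x a b w))             ≡⟨ ΣV-cong (λ w → rotate² (λ x a b → attached x a b w)) ⟩
    ΣV (λ w → Σ3 (λ a b x → attached x a b w))             ≤⟨ ΣV-mono-≤ (λ w → ΣV-mono-≤ λ a → ΣV-mono-≤ λ b →
                                                                ΣV-attached≤loneEdge w a b) ⟩
    Σ3 loneEdge                                            ∎
    where
      open ≤-Reasoning
      rotate² : ∀ f → Σ3 f ≡ Σ3 (λ i j k → f k i j)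
      rotate² f = trans (Σ3-rotate f) (Σ3-rotate (λ i j k → f j k i))

  triangleFeet : Fin n → Fin n → Fin n → ℕ
  triangleFeet v a b = [ triEdges G v a b ≡ᵇ 3 ] * feetCount S v a b

  manyFeet : Fin n → Fin n → Fin n → Bool
  manyFeet v a b = (triEdges G v a b ≡ᵇ 3) ∧ (3 ≤ᵇ feetCount S v a b)

  triangleFeet≡Σattached : ∀ v a b → triangleFeet v a b ≡ attachedAt v a b + attachedAt a v b + attachedAt b v a
  triangleFeet≡Σattached v a b = begin
    triangleFeet v a b
      ≡⟨ trans (sym (ΣV-*ˡ [ triEdges G v a b ≡ᵇ 3 ] (λ w → [ isFoot S v a b w ])))
               (ΣV-cong (λ w → trans (sym ([∧]≡[]*[] (triEdges G v a b ≡ᵇ 3) (isFoot S v a b w))) (foot-split w))) ⟩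
    ΣV (λ w → attached v a b w + attached a v b w + attached b v a w)
      ≡⟨ trans (ΣV-distrib-+ (λ w → attached v a b w + attached a v b w) (attached b v a))
               (cong (_+ attachedAt b v a) (ΣV-distrib-+ (attached v a b) (attached a v b))) ⟩
    attachedAt v a b + attachedAt a v b + attachedAt b v a ∎
    where
      open ≡-Reasoning
      foot-split : ∀ w → [ (triEdges G v a b ≡ᵇ 3) ∧ isFoot S v a b w ] ≡
                         attached v a b w + attached a v b w + attached b v a w
      foot-split w = trans
        ([]≡Σ[∧] ((triEdges G v a b ≡ᵇ 3) ∧ isFoot S v a b w) (adj G w v) (adj G w a) (adj G w b) one)
        (cong₂ (λ x y → attached v a b w + [ x ∧ adj G w a ] + [ y ∧ adj G w b ]) at-a at-b)
        where
          one : T ((triEdges G v a b ≡ᵇ 3) ∧ isFoot S v a b w) → [ adj G w v ] + [ adj G w a ] + [ adj G w b ] ≡ 1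
          one t with T-∧⁻ {triEdges G v a b ≡ᵇ 3} t
          ... | tri , foot = foot-adjacency-count (triEdges≡3⇒Triangle tri) (proj₂ (isFoot⁻ foot))
          at-a : (triEdges G v a b ≡ᵇ 3) ∧ isFoot S v a b w ≡ (triEdges G a v b ≡ᵇ 3) ∧ isFoot S a v b w
          at-a = cong₂ (λ e f → (e ≡ᵇ 3) ∧ f) (triEdges-swap₁₂ v a b) (isFoot-swap₁₂ v a b w)
          at-b : (triEdges G v a b ≡ᵇ 3) ∧ isFoot S v a b w ≡ (triEdges G b v a ≡ᵇ 3) ∧ isFoot S b v a w
          at-b = cong₂ (λ e f → (e ≡ᵇ 3) ∧ f) (trans (triEdges-swap₂₃ v a b) (triEdges-swap₁₂ v b a))
                                               (trans (isFoot-swap₂₃ v a b w) (isFoot-swap₁₂ v b a w))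

  module _ (diameter≤2 : ∀ x y → T (dist≤2 (adj G) x y))
           (edge-critical : ∀ a b → T (adj G a b) → ∃[ x ] ∃[ y ] T (not (dist≤2 (delEdge (adj G) a b) x y)))
           where

    far⇒foot : ∀ {x y z w} → Triangle x y z → w ~ x → Far x y w y →
      T (pathInP S w x y) × ¬ w ~ z × Outside w x y z
    far⇒foot {x} {y} {z} {w} (x~y , x~z , y~z) w~x far = path , w≁z , w≢x , w≢y , w≢z
      where
        w≢x : ¬ w ≡ x
        w≢x = ~⇒≢ w~x
        w≢y : ¬ w ≡ y
        w≢y refl = far Close-refl
        w≁y : ¬ w ~ y
        w≁y w~y = far (Close-edge (survives w~y w≢x w≢y))
        w≁z : ¬ w ~ z
        w≁z w~z = far (Close-path z (survives w~z w≢x w≢y)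
                                    (survives (~-sym y~z) (λ z≡x → ~⇒≢ x~z (sym z≡x)) (λ z≡y → ~⇒≢ y~z (sym z≡y))))
        w≢z : ¬ w ≡ z
        w≢z refl = w≁y (~-sym y~z)
        w≠y : T (not (w =ᶠ y))
        w≠y = T-not⁺ (λ e → w≢y (T-=ᶠ⇒≡ e))
        w≁ᵇy : T (not (adj G w y))
        w≁ᵇy = T-not⁺ (λ e → w≁y (adjacent e))
        associated : T (assoc G w y x y)
        associated = T-∧⁺ (edge x~y) (T-∧⁺ (diameter≤2 w y) (T-not⁺ (λ c → far (close c))))
        crit : T (critical G w y)
        crit = T-∧⁺ w≠y (anyV⁺ _ x (anyV⁺ _ y associated))
        mid≡x : mid S w y ≡ x
        mid≡x with mid S w y ≟ x | mid-adj S w y crit w≁ᵇy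
        ... | yes m≡x | _          = m≡x
        ... | no  m≢x | w~m , m~y  =
          ⊥-elim (far (Close-path (mid S w y) (survives (adjacent w~m) w≢x w≢y)
                                              (survives (adjacent m~y) m≢x (adj⇒≢ m~y))))
        path : T (pathInP S w x y)
        path = T-∧⁺ w≠y (T-∧⁺ w≁ᵇy (T-∧⁺ crit (T-∧⁺ (subst (λ m → T (m =ᶠ x)) (sym mid≡x) (T-=ᶠ-refl x)) associated)))

    -- the feet produced by the criticality of the edge ab
    EdgeFoot : Fin n → Fin n → Fin n → Fin n → Set
    EdgeFoot a b c w = T (isFoot S a b c w) × ¬ w ~ c × (w ~ a ⊎ w ~ b)

    via-a : ∀ {a b c w} → Triangle a b c → w ~ a → Far a b w b → EdgeFoot a b c w
    via-a t w~a far with far⇒foot t w~a far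
    ... | path , w≁c , outside = isFoot⁺ outside (inj₁ path) , w≁c , inj₁ w~a

    via-b : ∀ {a b c w} → Triangle a b c → w ~ b → Far a b w a → EdgeFoot a b c w
    via-b t w~b far with far⇒foot (Triangle-swap₁₂ t) w~b (Far-swap far)
    ... | path , w≁c , (w≢b , w≢a , w≢c) = isFoot⁺ (w≢a , w≢b , w≢c) (inj₂ path) , w≁c , inj₂ w~b

    Far⇒¬~ : ∀ {a b c x y} → Triangle a b c → Far a b x y → ¬ x ~ y
    Far⇒¬~ {c = c} (a~b , a~c , b~c) far x~y with destroyed x~y (λ s → far (Close-edge s))
    ... | inj₁ (refl , refl) =
      far (Close-path c (survives′ a~c (~⇒≢′ a~c) (~⇒≢′ b~c)) (survives (~-sym b~c) (~⇒≢′ a~c) (~⇒≢′ b~c)))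
    ... | inj₂ (refl , refl) =
      far (Close-path c (survives′ b~c (~⇒≢′ a~c) (~⇒≢′ b~c)) (survives (~-sym a~c) (~⇒≢′ a~c) (~⇒≢′ b~c)))

    -- the shortest x–y path in G must use the deleted edge ab
    far-pair⇒foot : ∀ {a b c x y} → Triangle a b c → Far a b x y → ∃[ w ] EdgeFoot a b c w
    far-pair⇒foot {a} {b} {c} {x} {y} t far with dist≤2-cases {B = adj G} x y (diameter≤2 x y)
    ... | inj₁ refl     = ⊥-elim (far Close-refl)
    ... | inj₂ (inj₁ e) = ⊥-elim (Far⇒¬~ t far (adjacent e))
    ... | inj₂ (inj₂ (u , e₁ , e₂)) with T? (delEdge (adj G) a b x u)
    ...   | yes s₁ with destroyed (adjacent e₂) (λ s₂ → far (Close-path u (surviving s₁) s₂))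
    ...     | inj₁ (refl , refl) = x , via-a t (adjacent e₁) far
    ...     | inj₂ (refl , refl) = x , via-b t (adjacent e₁) far
    far-pair⇒foot t far | inj₂ (inj₂ (u , e₁ , e₂)) | no ¬s₁
      with destroyed (adjacent e₁) (λ s₁ → ¬s₁ (Survives.edge s₁))
    ...     | inj₁ (refl , refl) = _ , via-b t (~-sym (adjacent e₂)) (Far-sym far)
    ...     | inj₂ (refl , refl) = _ , via-a t (~-sym (adjacent e₂)) (Far-sym far)

    edge-foot : ∀ {a b c} → Triangle a b c → ∃[ w ] EdgeFoot a b c w
    edge-foot {a} {b} t@(a~b , _ , _) with edge-critical a b (edge a~b)
    ... | x , y , ¬close = far-pair⇒foot {x = x} {y} t (λ (close d) → T-not⁻ ¬close d)

    two-feet : ∀ {a b c} → Triangle a b c → 2 ≤ feetCount S a b c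
    two-feet {a} {b} {c} t
      with edge-foot t | edge-foot (Triangle-swap₂₃ (Triangle-swap₁₂ t)) | edge-foot (Triangle-swap₂₃ t)
    ... | w₁ , f₁ , _ , inj₁ w₁~a | w₂ , f₂ , w₂≁a , _ | _ =
      two-distinct-feet {w = w₁} {w₂} f₁ (subst T (sym (trans (isFoot-swap₁₂ a b c w₂) (isFoot-swap₂₃ b a c w₂))) f₂)
                        (λ { refl → w₂≁a w₁~a })
    ... | w₁ , f₁ , _ , inj₂ w₁~b | _ | w₃ , f₃ , w₃≁b , _ =
      two-distinct-feet {w = w₁} {w₃} f₁ (subst T (sym (isFoot-swap₂₃ a b c w₃)) f₃) (λ { refl → w₃≁b w₁~b })

    triangle-weight≤feet : ∀ v a b →
      2 * hasEdges 3 v a b + [ manyFeet v a b ] * [ distinct v a b ] ≤ triangleFeet v a b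
    triangle-weight≤feet v a b = weight (triEdges G v a b ≡ᵇ 3) (distinct v a b) (feetCount S v a b) facts
      where
        facts : T (triEdges G v a b ≡ᵇ 3) → T (distinct v a b) × 2 ≤ feetCount S v a b
        facts tri = Triangle⇒distinct (triEdges≡3⇒Triangle tri) , two-feet (triEdges≡3⇒Triangle tri)
        weight : ∀ t d F → (T t → T d × 2 ≤ F) → 2 * ([ t ] * [ d ]) + [ t ∧ (3 ≤ᵇ F) ] * [ d ] ≤ [ t ] * F
        weight false d F _ = z≤n
        weight true  d F facts with facts _
        ... | dt , 2≤F rewrite T⇒≡true dt | +-identityʳ F = two-or-more F 2≤F
          where
            two-or-more : ∀ F → 2 ≤ F → 2 + [ 3 ≤ᵇ F ] * 1 ≤ F
            two-or-more (suc zero)          (s≤s ())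
            two-or-more (suc (suc zero))    _ = ≤-refl
            two-or-more (suc (suc (suc F))) _ = s≤s (s≤s (s≤s z≤n))

    feet-bound : 2 * triples 3 + Σ3 (λ v a b → [ manyFeet v a b ] * [ distinct v a b ]) ≤ triples 1
    feet-bound = begin
      2 * triples 3 + Σ3 (λ v a b → [ manyFeet v a b ] * [ distinct v a b ])
        ≡⟨ sym (trans (Σ3-distrib-+ (λ v a b → 2 * hasEdges 3 v a b) many)
                      (cong (_+ Σ3 many) (Σ3-*ˡ 2 (hasEdges 3)))) ⟩
      Σ3 (λ v a b → 2 * hasEdges 3 v a b + [ manyFeet v a b ] * [ distinct v a b ])
        ≤⟨ Σ3-mono-≤ triangle-weight≤feet ⟩
      Σ3 triangleFeet
        ≡⟨ Σ3-cong triangleFeet≡Σattached ⟩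
      Σ3 (λ v a b → attachedAt v a b + attachedAt a v b + attachedAt b v a)
        ≡⟨ Σ3-positions attachedAt ⟩
      3 * Σ3 attachedAt
        ≤⟨ *-monoʳ-≤ 3 Σ3attachedAt≤Σ3loneEdge ⟩
      3 * Σ3 loneEdge
        ≡⟨ sym triples₁≡3*Σ3loneEdge ⟩
      triples 1 ∎
      where
        open ≤-Reasoning
        many : Fin n → Fin n → Fin n → ℕ
        many v a b = [ manyFeet v a b ] * [ distinct v a b ]

module DegreeBound {n : ℕ} (G : Graph n) (S : PathSelection G)
         (diameter≤2 : ∀ x y → T (dist≤2 (adj G) x y))
         (edge-critical : ∀ a b → T (adj G a b) → ∃[ x ] ∃[ y ] T (not (dist≤2 (delEdge (adj G) a b) x y)))
         where

  open import Data.Nat using (_≤_)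
  open import Data.Nat.Properties
    using (*-cancelˡ-≤; +-monoʳ-≤; +-monoˡ-≤; *-monoˡ-≤; *-monoʳ-≤; m≤m+n; module ≤-Reasoning)
  open Counts G
  open Feet G S

  manyFeet≡6*countT3* : Σ3 (λ v a b → [ manyFeet v a b ] * [ distinct v a b ]) ≡ 6 * countT3* S
  manyFeet≡6*countT3* = Σ3-distinct≡6*ΣTriples manyFeet
    (λ i j k → cong₂ (λ e f → (e ≡ᵇ 3) ∧ (3 ≤ᵇ f)) (triEdges-swap₁₂ i j k) (feetCount-swap₁₂ i j k))
    (λ i j k → cong₂ (λ e f → (e ≡ᵇ 3) ∧ (3 ≤ᵇ f)) (triEdges-swap₂₃ i j k) (feetCount-swap₂₃ i j k))

  weighted-bound : 5 * sumDegSq G + 2 * countT2 G + 6 * countT3* S ≤ 6 * (n * edgeCount G)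
  weighted-bound = *-cancelˡ-≤ 3 (begin
    3 * (5 * sumDegSq G + 2 * t₂ + 6 * t₃)
      ≡⟨ cong (λ s → 3 * (5 * s + 2 * t₂ + 6 * t₃)) sumDegSq≡adjacentPairs+cherries ⟩
    3 * (5 * (M + P) + 2 * t₂ + 6 * t₃)
      ≡⟨ expand M P t₂ t₃ ⟩
    15 * M + 5 * (3 * P) + 6 * t₂ + 3 * (6 * t₃)
      ≡⟨ cong₂ (λ x y → 15 * M + 5 * x + y + 3 * (6 * t₃)) cherries-by-class (sym triples₂≡6*countT2) ⟩
    15 * M + 5 * (N₂ + 3 * N₃) + N₂ + 3 * (6 * t₃)
      ≡⟨ cong (λ x → 15 * M + 5 * (N₂ + 3 * N₃) + N₂ + 3 * x) (sym manyFeet≡6*countT3*) ⟩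
    15 * M + 5 * (N₂ + 3 * N₃) + N₂ + 3 * F
      ≡⟨ isolate-feet M N₂ N₃ F ⟩
    15 * M + 6 * N₂ + 9 * N₃ + 3 * (2 * N₃ + F)
      ≤⟨ +-monoʳ-≤ (15 * M + 6 * N₂ + 9 * N₃) (*-monoʳ-≤ 3 (feet-bound diameter≤2 edge-critical)) ⟩
    15 * M + 6 * N₂ + 9 * N₃ + 3 * N₁
      ≡⟨ collect-triples M N₁ N₂ N₃ ⟩
    15 * M + 3 * (N₁ + 2 * N₂ + 3 * N₃)
      ≡⟨ cong (λ x → 15 * M + 3 * x) (sym edgeTriples-by-class) ⟩
    15 * M + 3 * (3 * Q)
      ≤⟨ +-monoˡ-≤ (3 * (3 * Q)) (*-monoˡ-≤ M (m≤m+n 15 3)) ⟩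
    18 * M + 3 * (3 * Q)
      ≡⟨ collect-pairs M Q ⟩
    9 * (2 * M + Q)
      ≡⟨ cong (9 *_) (sym n*adjacentPairs≡2*adjacentPairs+edgeTriples) ⟩
    9 * (n * M)
      ≡⟨ cong (λ x → 9 * (n * x)) adjacentPairs≡2*edgeCount ⟩
    9 * (n * (2 * edgeCount G))
      ≡⟨ to-edgeCount n (edgeCount G) ⟩
    3 * (6 * (n * edgeCount G)) ∎)
    where
      open ≤-Reasoning
      M = adjacentPairs
      P = cherries
      Q = edgeTriples
      N₁ = triples 1
      N₂ = triples 2
      N₃ = triples 3
      F = Σ3 (λ v a b → [ manyFeet v a b ] * [ distinct v a b ])
      t₂ = countT2 G
      t₃ = countT3* S
      expand : ∀ M P t₂ t₃ → 3 * (5 * (M + P) + 2 * t₂ + 6 * t₃) ≡ 15 * M + 5 * (3 * P) + 6 * t₂ + 3 * (6 * t₃)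
      expand = solve-∀
      isolate-feet : ∀ M N₂ N₃ F → 15 * M + 5 * (N₂ + 3 * N₃) + N₂ + 3 * F ≡ 15 * M + 6 * N₂ + 9 * N₃ + 3 * (2 * N₃ + F)
      isolate-feet = solve-∀
      collect-triples : ∀ M N₁ N₂ N₃ → 15 * M + 6 * N₂ + 9 * N₃ + 3 * N₁ ≡ 15 * M + 3 * (N₁ + 2 * N₂ + 3 * N₃)
      collect-triples = solve-∀
      collect-pairs : ∀ M Q → 18 * M + 3 * (3 * Q) ≡ 9 * (2 * M + Q)
      collect-pairs = solve-∀
      to-edgeCount : ∀ n m → 9 * (n * (2 * m)) ≡ 3 * (6 * (n * m))
      to-edgeCount = solve-∀

open DegreeBound using (weighted-bound)

module Scaling where

  import Data.Nat as ℕ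
  open import Data.Nat.Properties using (m≤n⇒∃[o]m+o≡n)
  open import Data.Integer using (+_)
  import Data.Integer as ℤ
  import Data.Integer.Properties as ℤ
  import Data.Integer.Tactic.RingSolver as ℤ
  import Data.Rational as ℚ
  open import Data.Rational using (ℚ; _/_; toℚᵘ)
  open import Data.Rational.Properties
    using (toℚᵘ-injective; toℚᵘ-fromℚᵘ; toℚᵘ-homo-+; toℚᵘ-homo-*; normalize-nonNeg; normalize-pos;
           nonNegative⁻¹; +-monoʳ-≤; +-monoˡ-≤; neg-antimono-≤; *-monoˡ-≤-nonNeg; *-cancelˡ-≤-pos;
           module ≤-Reasoning)
  import Data.Rational.Unnormalised as ℚᵘ
  import Data.Rational.Unnormalised.Properties as ℚᵘ
  open import Data.Rational.Solver using (module +-*-Solver)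

  toℚᵘ-ℕ→ℚ : ∀ k → toℚᵘ (ℕ→ℚ k) ℚᵘ.≃ ℚᵘ.mkℚᵘ (+ k) 0
  toℚᵘ-ℕ→ℚ k = toℚᵘ-fromℚᵘ (ℚᵘ.mkℚᵘ (+ k) 0)

  ℕ→ℚ-+ : ∀ a b → ℕ→ℚ (a ℕ.+ b) ≡ ℕ→ℚ a ℚ.+ ℕ→ℚ b
  ℕ→ℚ-+ a b = toℚᵘ-injective (ℚᵘ.≃-trans (toℚᵘ-ℕ→ℚ (a ℕ.+ b)) (ℚᵘ.≃-sym (ℚᵘ.≃-trans
    (toℚᵘ-homo-+ (ℕ→ℚ a) (ℕ→ℚ b))
    (ℚᵘ.≃-trans (ℚᵘ.+-cong (toℚᵘ-ℕ→ℚ a) (toℚᵘ-ℕ→ℚ b))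
                 (ℚᵘ.*≡* (trans (sum-form (+ a) (+ b)) (cong (ℤ._* + 1) (sym (ℤ.pos-+ a b)))))))))
    where
      sum-form : ∀ x y → (x ℤ.* + 1 ℤ.+ y ℤ.* + 1) ℤ.* + 1 ≡ (x ℤ.+ y) ℤ.* + 1
      sum-form = ℤ.solve-∀

  ℕ→ℚ-* : ∀ a b → ℕ→ℚ (a ℕ.* b) ≡ ℕ→ℚ a ℚ.* ℕ→ℚ b
  ℕ→ℚ-* a b = toℚᵘ-injective (ℚᵘ.≃-trans (toℚᵘ-ℕ→ℚ (a ℕ.* b)) (ℚᵘ.≃-sym (ℚᵘ.≃-trans
    (toℚᵘ-homo-* (ℕ→ℚ a) (ℕ→ℚ b))
    (ℚᵘ.≃-trans (ℚᵘ.*-cong (toℚᵘ-ℕ→ℚ a) (toℚᵘ-ℕ→ℚ b))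
                 (ℚᵘ.*≡* (cong (ℤ._* + 1) (sym (ℤ.pos-* a b))))))))

  ℕ→ℚ-mono-≤ : ∀ {a b} → a ℕ.≤ b → ℕ→ℚ a ℚ.≤ ℕ→ℚ b
  ℕ→ℚ-mono-≤ {a} a≤b with m≤n⇒∃[o]m+o≡n a≤b
  ... | k , refl = begin
    ℕ→ℚ a             ≡⟨ sym (Data.Rational.Properties.+-identityʳ (ℕ→ℚ a)) ⟩
    ℕ→ℚ a ℚ.+ ℚ.0ℚ    ≤⟨ +-monoʳ-≤ (ℕ→ℚ a) (nonNegative⁻¹ (ℕ→ℚ k) {{normalize-nonNeg k 1}}) ⟩
    ℕ→ℚ a ℚ.+ ℕ→ℚ k   ≡⟨ sym (ℕ→ℚ-+ a k) ⟩
    ℕ→ℚ (a ℕ.+ k)     ∎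
    where open ≤-Reasoning

  -- the hypothesis k r = 5 says r = 5 / k
  rescale : ∀ (k : ℕ) (r : ℚ) → ℕ→ℚ k ℚ.* r ≡ ℕ→ℚ 5 → ∀ s t N (c : ℚ) →
    5 ℕ.* s ℕ.+ k ℕ.* t ℕ.≤ 6 ℕ.* N → (r ℚ.* c) ℚ.* ℕ→ℚ N ℚ.≤ ℕ→ℚ t →
    ℕ→ℚ s ℚ.≤ (+ 6 / 5 ℚ.- c) ℚ.* ℕ→ℚ N
  rescale k r k*r≡5 s t N c counts bound = *-cancelˡ-≤-pos 5ℚ {{normalize-pos 5 1}} (begin
    5ℚ ℚ.* S                                  ≡⟨ add-sub (5ℚ ℚ.* S) (K ℚ.* Tq) ⟩
    (5ℚ ℚ.* S ℚ.+ K ℚ.* Tq) ℚ.- K ℚ.* Tq        ≤⟨ +-monoˡ-≤ (ℚ.- (K ℚ.* Tq)) counts′ ⟩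
    6ℚ ℚ.* M ℚ.- K ℚ.* Tq                      ≤⟨ +-monoʳ-≤ (6ℚ ℚ.* M) (neg-antimono-≤
                                                    (*-monoˡ-≤-nonNeg K {{normalize-nonNeg k 1}} bound)) ⟩
    6ℚ ℚ.* M ℚ.- K ℚ.* ((r ℚ.* c) ℚ.* M)      ≡⟨ cong (λ x → 6ℚ ℚ.* M ℚ.- x) (reassoc K r c M) ⟩
    6ℚ ℚ.* M ℚ.- (K ℚ.* r) ℚ.* (c ℚ.* M)      ≡⟨ cong (λ x → 6ℚ ℚ.* M ℚ.- x ℚ.* (c ℚ.* M)) k*r≡5 ⟩
    6ℚ ℚ.* M ℚ.- 5ℚ ℚ.* (c ℚ.* M)             ≡⟨ factor c M ⟩
    5ℚ ℚ.* ((+ 6 / 5 ℚ.- c) ℚ.* M)            ∎)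
    where
      open ≤-Reasoning
      open +-*-Solver
      S = ℕ→ℚ s
      Tq = ℕ→ℚ t
      M = ℕ→ℚ N
      K = ℕ→ℚ k
      5ℚ = ℕ→ℚ 5
      6ℚ = ℕ→ℚ 6
      counts′ : 5ℚ ℚ.* S ℚ.+ K ℚ.* Tq ℚ.≤ 6ℚ ℚ.* M
      counts′ = begin
        5ℚ ℚ.* S ℚ.+ K ℚ.* Tq        ≡⟨ sym (trans (ℕ→ℚ-+ (5 ℕ.* s) (k ℕ.* t)) (cong₂ ℚ._+_ (ℕ→ℚ-* 5 s) (ℕ→ℚ-* k t))) ⟩
        ℕ→ℚ (5 ℕ.* s ℕ.+ k ℕ.* t)   ≤⟨ ℕ→ℚ-mono-≤ counts ⟩
        ℕ→ℚ (6 ℕ.* N)               ≡⟨ ℕ→ℚ-* 6 N ⟩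
        6ℚ ℚ.* M                    ∎
      add-sub : ∀ x y → x ≡ (x ℚ.+ y) ℚ.- y
      add-sub = solve 2 (λ x y → x := (x :+ y) :- y) refl
      reassoc : ∀ a b x y → a ℚ.* ((b ℚ.* x) ℚ.* y) ≡ (a ℚ.* b) ℚ.* (x ℚ.* y)
      reassoc = solve 4 (λ a b x y → a :* ((b :* x) :* y) := (a :* b) :* (x :* y)) refl
      factor : ∀ x y → 6ℚ ℚ.* y ℚ.- 5ℚ ℚ.* (x ℚ.* y) ≡ 5ℚ ℚ.* ((+ 6 / 5 ℚ.- x) ℚ.* y)
      factor = solve 2 (λ x y → con 6ℚ :* y :- con 5ℚ :* (x :* y) := con 5ℚ :* ((con (+ 6 / 5) :- x) :* y)) refl

open Scaling using (rescale)

open import Data.Nat.Properties using (≤-trans; m≤m+n; +-monoˡ-≤)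
open import Data.Integer using (+_)
open import Data.Rational using (ℚ; _/_; _<_; _≤_; _-_) renaming (_*_ to _*ℚ_)

lemma4p5 : ∀ {n} (G : Graph n) → Diameter2Critical G → (S : PathSelection G) →
    (c : ℚ) → ℕ→ℚ 0 < c →
    ((((+ 5 / 2) *ℚ c) *ℚ ℕ→ℚ (n * edgeCount G) ≤ ℕ→ℚ (countT2 G))
      ⊎ (((+ 5 / 6) *ℚ c) *ℚ ℕ→ℚ (n * edgeCount G) ≤ ℕ→ℚ (countT3* S))) →
    ℕ→ℚ (sumDegSq G) ≤ ((+ 6 / 5) - c) *ℚ ℕ→ℚ (n * edgeCount G)
lemma4p5 {n} G ((diameter≤2 , _) , edge-critical) S c _ =
  [ rescale 2 (+ 5 / 2) refl s t₂ N c (≤-trans (m≤m+n (5 * s + 2 * t₂) (6 * t₃)) bound)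
  , rescale 6 (+ 5 / 6) refl s t₃ N c (≤-trans (+-monoˡ-≤ (6 * t₃) (m≤m+n (5 * s) (2 * t₂))) bound)
  ]′
  where
    s = sumDegSq G
    t₂ = countT2 G
    t₃ = countT3* S
    N = n * edgeCount G
    bound = weighted-bound G S diameter≤2 edge-critical
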